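{- Let $A$ be an $\mathrm{inv}$-symmetric $V\times V$ matrix over $GF(4)$, and let $M$ be the matroid on $U=V\times\{1,2,3\}$ represented over $GF(4)$ by the $V\times U$ matrix whose columns indexed by $(v,1)$, $(v,2)$, $(v,3)$ are the $v$-th columns of $I$, $A$ and $A+I$, respectively. Let $\Omega=\{\{(v,1),(v,2),(v,3)\}:v\in V\}$. Then $M$ shelters a tight $3$-matroid $Z$ over $(U,\Omega)$.
   Context: $\mathrm{inv}$ is the unique nontrivial field automorphism of $GF(4)$; a square matrix $A$ is $\mathrm{inv}$-symmetric if applying $\mathrm{inv}$ entrywise to $A^T$ gives $A$. A carrier is $(U,\Omega)$ with $\Omega$ a partition of finite $U$ into skew classes; a skew pair is a 2-subset of a skew class; transversals meet each class in exactly one element, subtransversals are subsets of transversals. A semi-multimatroid $Z=(U,\Omega,\mathcal{C})$ has circuits $\mathcal{C}$ (subtransversals) such that each $Z[T]=(T,\mathcal{C}\cap 2^T)$, $T$ a transversal, is a matroid (by circuits); $Z[S]=(S,\mathcal C\cap 2^S)$ for subtransversals $S$. $Z$ is sheltered by $M$ if $Z[T]$ equals the restriction of $M$ to $T$ for every transversal $T$ (so $M$ and $(U,\Omega)$ determine $Z$). A multimatroid is a semi-multimatroid where no union of two circuits contains exactly one skew pair; it is tight if for every subtransversal $S$ with $|S|=|\Omega|-1$ and $\omega$ the class disjoint from $S$, some $x\in\omega$ makes the circuit families of $Z[S\cup\{x\}]$ and $Z[S]$ differ. A $3$-matroid is a multimatroid with all skew classes of size 3. -}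

module Defs where

open import Data.Nat using (ℕ; zero; suc; _+_; _∸_)
open import Data.Bool using (Bool; true; false; _∨_; if_then_else_)
open import Data.Fin using (Fin; zero; suc; _<_)
open import Data.Fin.Properties using (_≟_)
open import Data.Vec using (Vec; lookup; replicate; zipWith; updateAt; _[_]≔_)
open import Data.Product using (Σ; ∃; _×_; _,_)
open import Data.Sum using (_⊎_)
open import Relation.Nullary using (¬_; does)
open import Relation.Binary.PropositionalEquality using (_≡_; _≢_)

-- GF(4) = {0, 1, ω, ω²} with ω² = ω + 1

data GF4 : Set where
  𝟎 𝟏 ω ω² : GF4

infixl 6 _+₄_
infixl 7 _*₄_

_+₄_ : GF4 → GF4 → GF4
𝟎  +₄ y  = y
𝟏  +₄ 𝟎  = 𝟏
𝟏  +₄ 𝟏  = 𝟎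
𝟏  +₄ ω  = ω²
𝟏  +₄ ω² = ω
ω  +₄ 𝟎  = ω
ω  +₄ 𝟏  = ω²
ω  +₄ ω  = 𝟎
ω  +₄ ω² = 𝟏
ω² +₄ 𝟎  = ω²
ω² +₄ 𝟏  = ω
ω² +₄ ω  = 𝟏
ω² +₄ ω² = 𝟎

_*₄_ : GF4 → GF4 → GF4
𝟎  *₄ y  = 𝟎
𝟏  *₄ y  = y
ω  *₄ 𝟎  = 𝟎
ω  *₄ 𝟏  = ω
ω  *₄ ω  = ω²
ω  *₄ ω² = 𝟏
ω² *₄ 𝟎  = 𝟎
ω² *₄ 𝟏  = ω²
ω² *₄ ω  = 𝟏
ω² *₄ ω² = ω

-- the unique nontrivial field automorphism of GF(4) (Frobenius x ↦ x²)
inv : GF4 → GF4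
inv 𝟎  = 𝟎
inv 𝟏  = 𝟏
inv ω  = ω²
inv ω² = ω

Σ₄ : ∀ {m} → (Fin m → GF4) → GF4
Σ₄ {zero}  f = 𝟎
Σ₄ {suc m} f = f zero +₄ Σ₄ (λ i → f (suc i))

Matrix : ℕ → Set
Matrix n = Fin n → Fin n → GF4

InvSymmetric : ∀ {n} → Matrix n → Set
InvSymmetric {n} A = ∀ (i j : Fin n) → inv (A j i) ≡ A i j

δ : ∀ {n} → Fin n → Fin n → GF4
δ u v = if does (u ≟ v) then 𝟏 else 𝟎

-- U = V × {1,2,3}, encoded as Fin n × Fin 3 (0 ↦ 1, 1 ↦ 2, 2 ↦ 3).
-- Entry in row u of the column indexed by (v , k) of the matrix [ I | A | A+I ].
column : ∀ {n} → Matrix n → Fin n → Fin 3 → Fin n → GF4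
column A v zero             u = δ u v
column A v (suc zero)       u = A u v
column A v (suc (suc zero)) u = A u v +₄ δ u v

Sub : ℕ → Set
Sub n = Vec (Vec Bool 3) n

_∋_,_ : ∀ {n} → Sub n → Fin n → Fin 3 → Set
X ∋ v , i = lookup (lookup X v) i ≡ true

_⊆_ : ∀ {n} → Sub n → Sub n → Set
X ⊆ Y = ∀ v i → X ∋ v , i → Y ∋ v , i

_⊂_ : ∀ {n} → Sub n → Sub n → Set
X ⊂ Y = X ⊆ Y × Σ _ λ v → Σ (Fin 3) λ i → Y ∋ v , i × ¬ (X ∋ v , i)

∅ₛ : ∀ {n} → Sub n
∅ₛ = replicate _ (replicate _ false)

_∪_ : ∀ {n} → Sub n → Sub n → Sub n
X ∪ Y = zipWith (zipWith _∨_) X Y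

insert : ∀ {n} → Sub n → Fin n → Fin 3 → Sub n
insert X v i = updateAt X v (λ r → r [ i ]≔ true)

remove : ∀ {n} → Sub n → Fin n → Fin 3 → Sub n
remove X v i = updateAt X v (λ r → r [ i ]≔ false)

countRow : ∀ {m} → Vec Bool m → ℕ
countRow Vec.[] = 0
countRow (true  Vec.∷ r) = suc (countRow r)
countRow (false Vec.∷ r) = countRow r

∣_∣ : ∀ {n} → Sub n → ℕ
∣ Vec.[] ∣ = 0
∣ r Vec.∷ X ∣ = countRow r + ∣ X ∣

Dependent : ∀ {n} → Matrix n → Sub n → Set
Dependent {n} A X =
  Σ (Fin n → Fin 3 → GF4) λ c →
    (∀ v i → c v i ≢ 𝟎 → X ∋ v , i) ×
    (Σ (Fin n) λ v → Σ (Fin 3) λ i → c v i ≢ 𝟎) ×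
    (∀ u → Σ₄ (λ v → Σ₄ (λ i → c v i *₄ column A v i u)) ≡ 𝟎)

MCircuit : ∀ {n} → Matrix n → Sub n → Set
MCircuit A X = Dependent A X × (∀ Y → Y ⊂ X → ¬ Dependent A Y)

-- Carrier (U, Ω) with Ω = { {(v,1),(v,2),(v,3)} : v ∈ V }

Transversal : ∀ {n} → Sub n → Set
Transversal T = ∀ v → Σ (Fin 3) λ i → T ∋ v , i × (∀ j → T ∋ v , j → j ≡ i)

Subtransversal : ∀ {n} → Sub n → Set
Subtransversal S = Σ _ λ T → Transversal T × S ⊆ T

Family : ℕ → Set₁
Family n = Sub n → Set

restrict : ∀ {n} → Family n → Sub n → Family n
restrict 𝒞 S X = X ⊆ S × 𝒞 X

IsMatroidByCircuits : ∀ {n} → Sub n → Family n → Set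
IsMatroidByCircuits T 𝒟 =
  (∀ C → 𝒟 C → C ⊆ T) ×
  ¬ 𝒟 ∅ₛ ×
  (∀ C₁ C₂ → 𝒟 C₁ → 𝒟 C₂ → C₁ ⊆ C₂ → C₁ ≡ C₂) ×
  (∀ C₁ C₂ → 𝒟 C₁ → 𝒟 C₂ → C₁ ≢ C₂ → ∀ v i → C₁ ∋ v , i → C₂ ∋ v , i →
     Σ _ λ C₃ → 𝒟 C₃ × C₃ ⊆ remove (C₁ ∪ C₂) v i)

IsSemiMultimatroid : ∀ {n} → Family n → Set
IsSemiMultimatroid 𝒞 =
  (∀ C → 𝒞 C → Subtransversal C) ×
  (∀ T → Transversal T → IsMatroidByCircuits T (restrict 𝒞 T))

ExactlyOneSkewPair : ∀ {n} → Sub n → Set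
ExactlyOneSkewPair X =
  Σ _ λ v → Σ (Fin 3) λ i → Σ (Fin 3) λ j → i < j × X ∋ v , i × X ∋ v , j ×
    (∀ w k l → k < l → X ∋ w , k → X ∋ w , l → w ≡ v × k ≡ i × l ≡ j)

IsMultimatroid : ∀ {n} → Family n → Set
IsMultimatroid 𝒞 =
  IsSemiMultimatroid 𝒞 ×
  (∀ C₁ C₂ → 𝒞 C₁ → 𝒞 C₂ → ¬ ExactlyOneSkewPair (C₁ ∪ C₂))

-- all skew classes have size 3 by construction of the carrier, so a
-- multimatroid over this carrier is a 3-matroid
Is3Matroid : ∀ {n} → Family n → Set
Is3Matroid = IsMultimatroid

FamiliesDiffer : ∀ {n} → Family n → Family n → Set
FamiliesDiffer 𝒟₁ 𝒟₂ =
  Σ _ λ C → (𝒟₁ C × ¬ 𝒟₂ C) ⊎ (𝒟₂ C × ¬ 𝒟₁ C)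

IsTight : ∀ {n} → Family n → Set
IsTight {n} 𝒞 =
  ∀ S → Subtransversal S → ∣ S ∣ ≡ n ∸ 1 →
  ∀ v → (∀ i → ¬ (S ∋ v , i)) →
  Σ (Fin 3) λ x → FamiliesDiffer (restrict 𝒞 (insert S v x)) (restrict 𝒞 S)

ShelteredBy : ∀ {n} → Family n → Family n → Set
ShelteredBy MC 𝒞 =
  ∀ T → Transversal T → ∀ X →
    (restrict 𝒞 T X → restrict MC T X) × (restrict MC T X → restrict 𝒞 T X)

-- In the coordinates (p , q) of p A e_v + q e_v, the three columns at v are the points (0,1), (1,0),
-- (1,1) of GF(4)², and the linear relations among the columns are exactly the families with q = A p.
-- Since A is inv-symmetric, these graphs {(p , A p)} are totally isotropic for the Hermitian form
-- Σ_u (q_u inv p′_u + p_u inv q′_u).  For relations supported on subtransversals the summand at u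
-- vanishes unless the two relations use different columns at u; if the union of two circuits had
-- exactly one skew pair, exactly one summand would be nonzero, which gives the multimatroid axiom.
-- For tightness, a Fredholm alternative yields a p whose points (p_w , (A p)_w) lie on the lines
-- prescribed by S at every w ≠ v and are nonzero at v; isotropy forces the point at v onto one of
-- the three lines too (the only isotropic points of GF(4)²), which picks the new element x, and a
-- circuit through (v , x) inside S ∪ {(v , x)} is a circuit of Z[S ∪ {x}] but not of Z[S].

module Submission where

open import Defs
open import Algebra.Bundles using (Semiring)
open import Data.Bool using (Bool; true; false; _∨_; not; if_then_else_)
import Data.Bool.Properties as Bool
open import Data.Fin using (Fin; zero; suc)
import Data.Fin.Properties as Fin
open import Data.Nat using (ℕ; zero; suc; _+_; _≤_; _<_; _∸_; z≤n; s≤s)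
open import Data.Nat.Induction using (<-wellFounded)
open import Data.Nat.Properties using (≤-trans; n≤1+n; +-mono-≤; +-mono-<-≤; +-mono-≤-<; +-suc; 1+n≰n)
open import Data.Product using (Σ; ∃; ∃₂; _×_; _,_; proj₁; proj₂)
open import Data.Product.Properties using (≡-dec)
open import Data.Sum using (_⊎_; inj₁; inj₂; [_,_]′)
import Data.Sum as Sum
open import Data.Vec using (Vec; []; _∷_; lookup; replicate; zipWith; updateAt; _[_]≔_; tabulate)
open import Data.Vec.Properties
  using (lookup∘updateAt; lookup∘updateAt′; lookup-zipWith; lookup-replicate; lookup∘tabulate; tabulate∘lookup; tabulate-cong)
import Data.Vec.Functional as Vector
open import Data.Vec.Functional.Properties using (updateAt-updates; updateAt-minimal)
open import Function using (_∘_; case_of_)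
open import Induction.WellFounded using (Acc; acc)
open import Relation.Binary.Definitions using (DecidableEquality; tri<; tri≈; tri>)
open import Relation.Binary.PropositionalEquality
open import Relation.Nullary using (¬_; Dec; yes; no; does; contradiction)
open import Relation.Nullary.Decidable
  using (map′; _×-dec_; _⊎-dec_; _→-dec_; ¬?; from-yes; dec-true; dec-false; decidable-stable)
open import Relation.Unary using (Decidable)
open ≡-Reasoning

toFin : GF4 → Fin 4
toFin 𝟎  = zero
toFin 𝟏  = suc zero
toFin ω  = suc (suc zero)
toFin ω² = suc (suc (suc zero))

fromFin : Fin 4 → GF4
fromFin zero                   = 𝟎
fromFin (suc zero)             = 𝟏
fromFin (suc (suc zero))       = ω
fromFin (suc (suc (suc zero))) = ω²

fromFin∘toFin : ∀ a → fromFin (toFin a) ≡ a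
fromFin∘toFin 𝟎  = refl
fromFin∘toFin 𝟏  = refl
fromFin∘toFin ω  = refl
fromFin∘toFin ω² = refl

toFin-injective : ∀ {a b} → toFin a ≡ toFin b → a ≡ b
toFin-injective {a} {b} eq =
  trans (sym (fromFin∘toFin a)) (trans (cong fromFin eq) (fromFin∘toFin b))

infix 4 _≟₄_
_≟₄_ : DecidableEquality GF4
a ≟₄ b = map′ toFin-injective (cong toFin) (toFin a Fin.≟ toFin b)

all₄? : {P : GF4 → Set} → Decidable P → Dec (∀ a → P a)
all₄? P? = map′ (λ (p₀ , p₁ , pω , pω²) → λ { 𝟎 → p₀ ; 𝟏 → p₁ ; ω → pω ; ω² → pω² })
                (λ p → p 𝟎 , p 𝟏 , p ω , p ω²)
                (P? 𝟎 ×-dec P? 𝟏 ×-dec P? ω ×-dec P? ω²)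

+₄-comm : ∀ a b → a +₄ b ≡ b +₄ a
+₄-comm = from-yes (all₄? λ a → all₄? λ b → a +₄ b ≟₄ b +₄ a)

+₄-assoc : ∀ a b c → (a +₄ b) +₄ c ≡ a +₄ (b +₄ c)
+₄-assoc = from-yes (all₄? λ a → all₄? λ b → all₄? λ c → (a +₄ b) +₄ c ≟₄ a +₄ (b +₄ c))

*₄-assoc : ∀ a b c → (a *₄ b) *₄ c ≡ a *₄ (b *₄ c)
*₄-assoc = from-yes (all₄? λ a → all₄? λ b → all₄? λ c → (a *₄ b) *₄ c ≟₄ a *₄ (b *₄ c))

*₄-comm : ∀ a b → a *₄ b ≡ b *₄ a
*₄-comm = from-yes (all₄? λ a → all₄? λ b → a *₄ b ≟₄ b *₄ a)

*₄-distribˡ-+₄ : ∀ a b c → a *₄ (b +₄ c) ≡ a *₄ b +₄ a *₄ c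
*₄-distribˡ-+₄ = from-yes (all₄? λ a → all₄? λ b → all₄? λ c → a *₄ (b +₄ c) ≟₄ a *₄ b +₄ a *₄ c)

*₄-distribʳ-+₄ : ∀ a b c → (b +₄ c) *₄ a ≡ b *₄ a +₄ c *₄ a
*₄-distribʳ-+₄ = from-yes (all₄? λ a → all₄? λ b → all₄? λ c → (b +₄ c) *₄ a ≟₄ b *₄ a +₄ c *₄ a)

+₄-identityʳ : ∀ a → a +₄ 𝟎 ≡ a
+₄-identityʳ = from-yes (all₄? λ a → a +₄ 𝟎 ≟₄ a)

*₄-identityʳ : ∀ a → a *₄ 𝟏 ≡ a
*₄-identityʳ = from-yes (all₄? λ a → a *₄ 𝟏 ≟₄ a)

*₄-zeroʳ : ∀ a → a *₄ 𝟎 ≡ 𝟎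
*₄-zeroʳ = from-yes (all₄? λ a → a *₄ 𝟎 ≟₄ 𝟎)

gf4-semiring : Semiring _ _
gf4-semiring = record
  { Carrier = GF4 ; _≈_ = _≡_ ; _+_ = _+₄_ ; _*_ = _*₄_ ; 0# = 𝟎 ; 1# = 𝟏
  ; isSemiring = record
    { isSemiringWithoutAnnihilatingZero = record
      { +-isCommutativeMonoid = record
        { isMonoid = record
          { isSemigroup = record
            { isMagma = record { isEquivalence = isEquivalence ; ∙-cong = cong₂ _+₄_ }
            ; assoc = +₄-assoc }
          ; identity = (λ _ → refl) , +₄-identityʳ }
        ; comm = +₄-comm }
      ; *-cong = cong₂ _*₄_
      ; *-assoc = *₄-assoc
      ; *-identity = (λ _ → refl) , *₄-identityʳ
      ; distrib = *₄-distribˡ-+₄ , *₄-distribʳ-+₄ }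
    ; zero = (λ _ → refl) , *₄-zeroʳ } }

+₄-*₄-zeroʳ : ∀ a b → a +₄ b *₄ 𝟎 ≡ a
+₄-*₄-zeroʳ = from-yes (all₄? λ a → all₄? λ b → a +₄ b *₄ 𝟎 ≟₄ a)

x+₄x≡𝟎 : ∀ a → a +₄ a ≡ 𝟎
x+₄x≡𝟎 = from-yes (all₄? λ a → a +₄ a ≟₄ 𝟎)

+₄-cancelʳ : ∀ a b → (a +₄ b) +₄ b ≡ a
+₄-cancelʳ = from-yes (all₄? λ a → all₄? λ b → (a +₄ b) +₄ b ≟₄ a)

+₄≡𝟎⇒≡ : ∀ {a b} → a +₄ b ≡ 𝟎 → a ≡ b
+₄≡𝟎⇒≡ {a} {b} eq = trans (sym (+₄-cancelʳ a b)) (cong (_+₄ b) eq)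

inv-+₄ : ∀ a b → inv (a +₄ b) ≡ inv a +₄ inv b
inv-+₄ = from-yes (all₄? λ a → all₄? λ b → inv (a +₄ b) ≟₄ inv a +₄ inv b)

inv-*₄ : ∀ a b → inv (a *₄ b) ≡ inv a *₄ inv b
inv-*₄ = from-yes (all₄? λ a → all₄? λ b → inv (a *₄ b) ≟₄ inv a *₄ inv b)

inv-nonzero : ∀ {a} → a ≢ 𝟎 → inv a ≢ 𝟎
inv-nonzero {a} = from-yes (all₄? λ a → ¬? (a ≟₄ 𝟎) →-dec ¬? (inv a ≟₄ 𝟎)) a

*₄-nonzero : ∀ {a b} → a ≢ 𝟎 → b ≢ 𝟎 → a *₄ b ≢ 𝟎
*₄-nonzero {a} {b} = from-yes (all₄? λ a → all₄? λ b →
  ¬? (a ≟₄ 𝟎) →-dec ¬? (b ≟₄ 𝟎) →-dec ¬? (a *₄ b ≟₄ 𝟎)) a b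

_⁻¹ : GF4 → GF4
𝟎  ⁻¹ = 𝟎
𝟏  ⁻¹ = 𝟏
ω  ⁻¹ = ω²
ω² ⁻¹ = ω

+₄-eliminate : ∀ a {b} → b ≢ 𝟎 → a +₄ (a *₄ b ⁻¹) *₄ b ≡ 𝟎
+₄-eliminate a {b} = from-yes (all₄? λ a → all₄? λ b →
  ¬? (b ≟₄ 𝟎) →-dec (a +₄ (a *₄ b ⁻¹) *₄ b ≟₄ 𝟎)) a b

¬≢𝟎⇒≡𝟎 : ∀ {a} → ¬ (a ≢ 𝟎) → a ≡ 𝟎
¬≢𝟎⇒≡𝟎 {a} = decidable-stable (a ≟₄ 𝟎)

open import Algebra.Properties.Semiring.Sum gf4-semiring
  using (sum; ∑-distrib-+; ∑-comm; *-distribˡ-sum; *-distribʳ-sum; sum-cong-≗)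

Σ₄-cong : ∀ {m} {f g : Fin m → GF4} → (∀ i → f i ≡ g i) → Σ₄ f ≡ Σ₄ g
Σ₄-cong {zero}  eq = refl
Σ₄-cong {suc m} eq = cong₂ _+₄_ (eq zero) (Σ₄-cong (eq ∘ suc))

Σ₄≡sum : ∀ {m} (f : Fin m → GF4) → Σ₄ f ≡ sum f
Σ₄≡sum {zero}  f = refl
Σ₄≡sum {suc m} f = cong (f zero +₄_) (Σ₄≡sum (f ∘ suc))

Σ₄-distrib-+₄ : ∀ {m} (f g : Fin m → GF4) → Σ₄ (λ i → f i +₄ g i) ≡ Σ₄ f +₄ Σ₄ g
Σ₄-distrib-+₄ f g = begin
  Σ₄ (λ i → f i +₄ g i)  ≡⟨ Σ₄≡sum (λ i → f i +₄ g i) ⟩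
  sum (λ i → f i +₄ g i) ≡⟨ ∑-distrib-+ f g ⟩
  sum f +₄ sum g         ≡⟨ sym (cong₂ _+₄_ (Σ₄≡sum f) (Σ₄≡sum g)) ⟩
  Σ₄ f +₄ Σ₄ g           ∎

*₄-distribˡ-Σ₄ : ∀ {m} k (f : Fin m → GF4) → k *₄ Σ₄ f ≡ Σ₄ (λ i → k *₄ f i)
*₄-distribˡ-Σ₄ k f = begin
  k *₄ Σ₄ f            ≡⟨ cong (k *₄_) (Σ₄≡sum f) ⟩
  k *₄ sum f           ≡⟨ *-distribˡ-sum k f ⟩
  sum (λ i → k *₄ f i) ≡⟨ sym (Σ₄≡sum (λ i → k *₄ f i)) ⟩
  Σ₄ (λ i → k *₄ f i)  ∎

*₄-distribʳ-Σ₄ : ∀ {m} k (f : Fin m → GF4) → Σ₄ f *₄ k ≡ Σ₄ (λ i → f i *₄ k)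
*₄-distribʳ-Σ₄ k f = begin
  Σ₄ f *₄ k            ≡⟨ cong (_*₄ k) (Σ₄≡sum f) ⟩
  sum f *₄ k           ≡⟨ *-distribʳ-sum k f ⟩
  sum (λ i → f i *₄ k) ≡⟨ sym (Σ₄≡sum (λ i → f i *₄ k)) ⟩
  Σ₄ (λ i → f i *₄ k)  ∎

Σ₄-comm : ∀ {m k} (f : Fin m → Fin k → GF4) →
          Σ₄ (λ i → Σ₄ (f i)) ≡ Σ₄ (λ j → Σ₄ (λ i → f i j))
Σ₄-comm f = begin
  Σ₄ (λ i → Σ₄ (f i))                ≡⟨ trans (Σ₄≡sum (λ i → Σ₄ (f i))) (sum-cong-≗ (Σ₄≡sum ∘ f)) ⟩
  sum (λ i → sum (f i))              ≡⟨ ∑-comm f ⟩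
  sum (λ j → sum (λ i → f i j))
    ≡⟨ sym (trans (Σ₄≡sum (λ j → Σ₄ (λ i → f i j))) (sum-cong-≗ λ j → Σ₄≡sum (λ i → f i j))) ⟩
  Σ₄ (λ j → Σ₄ (λ i → f i j))        ∎

inv-Σ₄ : ∀ {m} (f : Fin m → GF4) → inv (Σ₄ f) ≡ Σ₄ (inv ∘ f)
inv-Σ₄ {zero}  f = refl
inv-Σ₄ {suc m} f = trans (inv-+₄ (f zero) _) (cong (inv (f zero) +₄_) (inv-Σ₄ (f ∘ suc)))

Σ₄-zeros : ∀ {m} (f : Fin m → GF4) → (∀ i → f i ≡ 𝟎) → Σ₄ f ≡ 𝟎
Σ₄-zeros {zero}  f eq = refl
Σ₄-zeros {suc m} f eq = cong₂ _+₄_ (eq zero) (Σ₄-zeros (f ∘ suc) (eq ∘ suc))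

Σ₄-supported-at : ∀ {m} (f : Fin m → GF4) u → (∀ i → i ≢ u → f i ≡ 𝟎) → Σ₄ f ≡ f u
Σ₄-supported-at {suc m} f zero    eq =
  trans (cong (f zero +₄_) (Σ₄-zeros (f ∘ suc) λ i → eq (suc i) λ ())) (+₄-identityʳ _)
Σ₄-supported-at {suc m} f (suc u) eq =
  cong₂ _+₄_ (eq zero λ ()) (Σ₄-supported-at (f ∘ suc) u λ i i≢u → eq (suc i) (i≢u ∘ Fin.suc-injective))

δ-refl : ∀ {n} (u : Fin n) → δ u u ≡ 𝟏
δ-refl u = cong (if_then 𝟏 else 𝟎) (dec-true (u Fin.≟ u) refl)

δ-≢ : ∀ {n} {u v : Fin n} → u ≢ v → δ u v ≡ 𝟎
δ-≢ {u = u} {v} u≢v = cong (if_then 𝟏 else 𝟎) (dec-false (u Fin.≟ v) u≢v)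

δ-sym : ∀ {n} (u v : Fin n) → δ u v ≡ δ v u
δ-sym u v = by-cases (u Fin.≟ v)
  where
  by-cases : Dec (u ≡ v) → δ u v ≡ δ v u
  by-cases (yes refl) = refl
  by-cases (no u≢v)   = trans (δ-≢ u≢v) (sym (δ-≢ (u≢v ∘ sym)))

Σ₄-δ : ∀ {n} (g : Fin n → GF4) u → Σ₄ (λ v → g v *₄ δ v u) ≡ g u
Σ₄-δ g u = begin
  Σ₄ (λ v → g v *₄ δ v u) ≡⟨ Σ₄-supported-at _ u (λ v v≢u → trans (cong (g v *₄_) (δ-≢ v≢u)) (*₄-zeroʳ _)) ⟩
  g u *₄ δ u u            ≡⟨ trans (cong (g u *₄_) (δ-refl u)) (*₄-identityʳ _) ⟩
  g u                     ∎

_∈?_ : ∀ {n} (X : Sub n) v i → Dec (X ∋ v , i)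
(X ∈? v) i = lookup (lookup X v) i Bool.≟ true

∉∅ : ∀ {n} v i → ¬ (∅ₛ {n} ∋ v , i)
∉∅ v i ∈∅ with () ← trans (sym ∈∅)
  (trans (cong (λ r → lookup r i) (lookup-replicate v _)) (lookup-replicate i false))

lookup-∪ : ∀ {n} (X Y : Sub n) v i →
           lookup (lookup (X ∪ Y) v) i ≡ lookup (lookup X v) i ∨ lookup (lookup Y v) i
lookup-∪ X Y v i = trans (cong (λ r → lookup r i) (lookup-zipWith (zipWith _∨_) v X Y))
                         (lookup-zipWith _∨_ i (lookup X v) (lookup Y v))

∈-∪⁺ˡ : ∀ {n} (X Y : Sub n) {v i} → X ∋ v , i → (X ∪ Y) ∋ v , i
∈-∪⁺ˡ X Y {v} {i} ∈X = trans (lookup-∪ X Y v i) (cong (_∨ _) ∈X)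

∈-∪⁺ʳ : ∀ {n} (X Y : Sub n) {v i} → Y ∋ v , i → (X ∪ Y) ∋ v , i
∈-∪⁺ʳ X Y {v} {i} ∈Y = trans (lookup-∪ X Y v i) (trans (cong (_ ∨_) ∈Y) (Bool.∨-zeroʳ _))

∈-∪⁻ : ∀ {n} (X Y : Sub n) {v i} → (X ∪ Y) ∋ v , i → X ∋ v , i ⊎ Y ∋ v , i
∈-∪⁻ X Y {v} {i} ∈X∪Y = split _ _ (trans (sym (lookup-∪ X Y v i)) ∈X∪Y)
  where
  split : ∀ a b → a ∨ b ≡ true → a ≡ true ⊎ b ≡ true
  split true  _ _  = inj₁ refl
  split false _ eq = inj₂ eq

-- insert X v i and remove X v i (from Defs) are definitionally set X v i true and set X v i false.
set : ∀ {n} → Sub n → Fin n → Fin 3 → Bool → Sub n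
set X v i b = updateAt X v (λ r → r [ i ]≔ b)

lookup-set-≡ : ∀ {n} (X : Sub n) v i b → lookup (lookup (set X v i b) v) i ≡ b
lookup-set-≡ X v i b = trans (cong (λ r → lookup r i) (lookup∘updateAt v X))
                             (lookup∘updateAt i (lookup X v))

lookup-set-≢ : ∀ {n} (X : Sub n) v i b {w j} → ¬ (w ≡ v × j ≡ i) →
               lookup (lookup (set X v i b) w) j ≡ lookup (lookup X w) j
lookup-set-≢ X v i b {w} {j} ≢vi with w Fin.≟ v
... | no w≢v    = cong (λ r → lookup r j) (lookup∘updateAt′ w v w≢v X)
... | yes refl  = trans (cong (λ r → lookup r j) (lookup∘updateAt v X))
                        (lookup∘updateAt′ j i (λ j≡i → ≢vi (refl , j≡i)) (lookup X v))

∈-insert-self : ∀ {n} (X : Sub n) v i → insert X v i ∋ v , i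
∈-insert-self X v i = lookup-set-≡ X v i true

∈-insert⁺ : ∀ {n} (X : Sub n) v i {w j} → X ∋ w , j → insert X v i ∋ w , j
∈-insert⁺ X v i {w} {j} ∈X with w Fin.≟ v ×-dec j Fin.≟ i
... | yes (refl , refl) = ∈-insert-self X v i
... | no ≢vi            = trans (lookup-set-≢ X v i true ≢vi) ∈X

∈-insert⁻ : ∀ {n} (X : Sub n) v i {w j} → insert X v i ∋ w , j → X ∋ w , j ⊎ (w ≡ v × j ≡ i)
∈-insert⁻ X v i {w} {j} ∈ins with w Fin.≟ v ×-dec j Fin.≟ i
... | yes ≡vi = inj₂ ≡vi
... | no ≢vi  = inj₁ (trans (sym (lookup-set-≢ X v i true ≢vi)) ∈ins)

∈-remove⁺ : ∀ {n} (X : Sub n) v i {w j} → X ∋ w , j → ¬ (w ≡ v × j ≡ i) → remove X v i ∋ w , j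
∈-remove⁺ X v i ∈X ≢vi = trans (lookup-set-≢ X v i false ≢vi) ∈X

∈-remove⁻ : ∀ {n} (X : Sub n) v i {w j} → remove X v i ∋ w , j → X ∋ w , j
∈-remove⁻ X v i {w} {j} ∈rem with w Fin.≟ v ×-dec j Fin.≟ i
... | yes (refl , refl) = case trans (sym ∈rem) (lookup-set-≡ X v i false) of λ ()
... | no ≢vi            = trans (sym (lookup-set-≢ X v i false ≢vi)) ∈rem

⊆-antisym : ∀ {n} {X Y : Sub n} → X ⊆ Y → Y ⊆ X → X ≡ Y
⊆-antisym {X = X} {Y} X⊆Y Y⊆X = vec-ext (λ v → vec-ext (λ i → bool-ext (X⊆Y v i) (Y⊆X v i)))
  where
  vec-ext : ∀ {A : Set} {m} {xs ys : Vec A m} → (∀ i → lookup xs i ≡ lookup ys i) → xs ≡ ys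
  vec-ext {xs = xs} {ys} eq =
    trans (sym (tabulate∘lookup xs)) (trans (tabulate-cong eq) (tabulate∘lookup ys))
  bool-ext : ∀ {a b : Bool} → (a ≡ true → b ≡ true) → (b ≡ true → a ≡ true) → a ≡ b
  bool-ext {false} {false} _ _ = refl
  bool-ext {false} {true}  _ g = g refl
  bool-ext {true}  {false} f _ = sym (f refl)
  bool-ext {true}  {true}  _ _ = refl

insert-subtransversal : ∀ {n} {S : Sub n} → Subtransversal S → ∀ {v} → (∀ i → ¬ (S ∋ v , i)) →
                        ∀ x → Subtransversal (insert S v x)
insert-subtransversal {S = S} (T , T-tr , S⊆T) {v} v∉S x = T′ , T′-tr , ins⊆T′
  where
  T′ : Sub _
  T′ = T [ v ]≔ (replicate 3 false [ x ]≔ true)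

  lookup-T′-v : ∀ j → lookup (lookup T′ v) j ≡ lookup (replicate 3 false [ x ]≔ true) j
  lookup-T′-v j = cong (λ r → lookup r j) (lookup∘updateAt v T)

  lookup-T′-w : ∀ {w} j → w ≢ v → lookup (lookup T′ w) j ≡ lookup (lookup T w) j
  lookup-T′-w j w≢v = cong (λ r → lookup r j) (lookup∘updateAt′ _ v w≢v T)

  x∈T′ : T′ ∋ v , x
  x∈T′ = trans (lookup-T′-v x) (lookup∘updateAt x (replicate 3 false))

  T′-tr : Transversal T′
  T′-tr w with w Fin.≟ v
  ... | yes refl = x , x∈T′ , only-x
    where
    only-x : ∀ j → T′ ∋ w , j → j ≡ x
    only-x j j∈T′ with j Fin.≟ x
    ... | yes j≡x = j≡x
    ... | no  j≢x with () ← trans (sym j∈T′) (trans (lookup-T′-v j)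
                        (trans (lookup∘updateAt′ j x j≢x (replicate 3 false)) (lookup-replicate j false)))
  ... | no w≢v = let (i , i∈T , unique) = T-tr w
                 in i , trans (lookup-T′-w i w≢v) i∈T , λ j j∈T′ → unique j (trans (sym (lookup-T′-w j w≢v)) j∈T′)

  ins⊆T′ : insert S v x ⊆ T′
  ins⊆T′ w j j∈ins with ∈-insert⁻ S v x j∈ins
  ... | inj₂ (refl , refl) = x∈T′
  ... | inj₁ j∈S with w Fin.≟ v
  ...   | yes refl = contradiction j∈S (v∉S j)
  ...   | no  w≢v  = trans (lookup-T′-w j w≢v) (S⊆T w j j∈S)

countRow-mono : ∀ {m} (r s : Vec Bool m) →
                (∀ i → lookup r i ≡ true → lookup s i ≡ true) → countRow r ≤ countRow s
countRow-mono []          []          _ = z≤n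
countRow-mono (true ∷ r)  (true ∷ s)  h = s≤s (countRow-mono r s (h ∘ suc))
countRow-mono (true ∷ r)  (false ∷ s) h with () ← h zero refl
countRow-mono (false ∷ r) (true ∷ s)  h = ≤-trans (countRow-mono r s (h ∘ suc)) (n≤1+n _)
countRow-mono (false ∷ r) (false ∷ s) h = countRow-mono r s (h ∘ suc)

countRow-strict : ∀ {m} (r s : Vec Bool m) → (∀ i → lookup r i ≡ true → lookup s i ≡ true) →
                  ∀ j → lookup s j ≡ true → lookup r j ≢ true → countRow r < countRow s
countRow-strict (true ∷ r)  (true ∷ s)  h zero    _  j∉r = contradiction refl j∉r
countRow-strict (true ∷ r)  (true ∷ s)  h (suc j) j∈s j∉r = s≤s (countRow-strict r s (h ∘ suc) j j∈s j∉r)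
countRow-strict (true ∷ r)  (false ∷ s) h _       _  _  with () ← h zero refl
countRow-strict (false ∷ r) (true ∷ s)  h _       _  _  = s≤s (countRow-mono r s (h ∘ suc))
countRow-strict (false ∷ r) (false ∷ s) h (suc j) j∈s j∉r = countRow-strict r s (h ∘ suc) j j∈s j∉r

∣∣-mono : ∀ {n} (X Y : Sub n) → X ⊆ Y → ∣ X ∣ ≤ ∣ Y ∣
∣∣-mono []      []      _   = z≤n
∣∣-mono (r ∷ X) (s ∷ Y) X⊆Y = +-mono-≤ (countRow-mono r s (X⊆Y zero)) (∣∣-mono X Y (X⊆Y ∘ suc))

∣∣-mono-⊂ : ∀ {n} (X Y : Sub n) → X ⊂ Y → ∣ X ∣ < ∣ Y ∣
∣∣-mono-⊂ (r ∷ X) (s ∷ Y) (X⊆Y , zero , j , j∈Y , j∉X) =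
  +-mono-<-≤ (countRow-strict r s (X⊆Y zero) j j∈Y j∉X) (∣∣-mono X Y (X⊆Y ∘ suc))
∣∣-mono-⊂ (r ∷ X) (s ∷ Y) (X⊆Y , suc v , j , j∈Y , j∉X) =
  +-mono-≤-< (countRow-mono r s (X⊆Y zero)) (∣∣-mono-⊂ X Y ((X⊆Y ∘ suc) , v , j , j∈Y , j∉X))

RowsAtMostOne : ∀ {n} → Sub n → Set
RowsAtMostOne X = ∀ w → countRow (lookup X w) ≤ 1

subtransversal⇒rowsAtMostOne : ∀ {n} {S : Sub n} → Subtransversal S → RowsAtMostOne S
subtransversal⇒rowsAtMostOne {S = S} (T , T-tr , S⊆T) w =
  atMostOne (lookup S w) λ j j′ j∈S j′∈S → trans (index j j∈S) (sym (index j′ j′∈S))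
  where
  index : ∀ j → S ∋ w , j → j ≡ _
  index j j∈S = let (_ , _ , unique) = T-tr w in unique j (S⊆T w j j∈S)
  atMostOne : (r : Vec Bool 3) → (∀ j j′ → lookup r j ≡ true → lookup r j′ ≡ true → j ≡ j′) →
              countRow r ≤ 1
  atMostOne (false ∷ false ∷ false ∷ []) _ = z≤n
  atMostOne (true  ∷ false ∷ false ∷ []) _ = s≤s z≤n
  atMostOne (false ∷ true  ∷ false ∷ []) _ = s≤s z≤n
  atMostOne (false ∷ false ∷ true  ∷ []) _ = s≤s z≤n
  atMostOne (true  ∷ true  ∷ _     ∷ []) u with () ← u zero (suc zero) refl refl
  atMostOne (true  ∷ false ∷ true  ∷ []) u with () ← u zero (suc (suc zero)) refl refl
  atMostOne (false ∷ true  ∷ true  ∷ []) u with () ← u (suc zero) (suc (suc zero)) refl refl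

countRow-empty : (r : Vec Bool 3) → (∀ j → lookup r j ≢ true) → countRow r ≡ 0
countRow-empty (false ∷ false ∷ false ∷ []) _ = refl
countRow-empty (true  ∷ _     ∷ _     ∷ []) e = contradiction refl (e zero)
countRow-empty (false ∷ true  ∷ _     ∷ []) e = contradiction refl (e (suc zero))
countRow-empty (false ∷ false ∷ true  ∷ []) e = contradiction refl (e (suc (suc zero)))

∣∣≤n : ∀ {n} (X : Sub n) → RowsAtMostOne X → ∣ X ∣ ≤ n
∣∣≤n []      _  = z≤n
∣∣≤n (r ∷ X) ≤1 = +-mono-≤ (≤1 zero) (∣∣≤n X (≤1 ∘ suc))

∣∣<n : ∀ {n} (X : Sub n) → RowsAtMostOne X → ∀ v → countRow (lookup X v) ≡ 0 → ∣ X ∣ < n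
∣∣<n (r ∷ X) ≤1 zero    r≡0 rewrite r≡0 = s≤s (∣∣≤n X (≤1 ∘ suc))
∣∣<n {suc n} (r ∷ X) ≤1 (suc v) X≡0 =
  subst (_≤ suc n) (+-suc (countRow r) ∣ X ∣) (+-mono-≤ (≤1 zero) (∣∣<n X (≤1 ∘ suc) v X≡0))

∣∣+2≤n : ∀ {n} (X : Sub n) → RowsAtMostOne X → ∀ v w → v ≢ w →
         countRow (lookup X v) ≡ 0 → countRow (lookup X w) ≡ 0 → 2 + ∣ X ∣ ≤ n
∣∣+2≤n (r ∷ X) ≤1 zero    zero    v≢w _   _   = contradiction refl v≢w
∣∣+2≤n (r ∷ X) ≤1 zero    (suc w) _   r≡0 X≡0 rewrite r≡0 = s≤s (∣∣<n X (≤1 ∘ suc) w X≡0)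
∣∣+2≤n (r ∷ X) ≤1 (suc v) zero    _   X≡0 r≡0 rewrite r≡0 = s≤s (∣∣<n X (≤1 ∘ suc) v X≡0)
∣∣+2≤n {suc n} (r ∷ X) ≤1 (suc v) (suc w) v≢w X≡0 X≡0′ =
  subst (_≤ suc n) (trans (+-suc (countRow r) (suc ∣ X ∣)) (cong suc (+-suc (countRow r) ∣ X ∣)))
        (+-mono-≤ (≤1 zero) (∣∣+2≤n X (≤1 ∘ suc) v w (v≢w ∘ cong suc) X≡0 X≡0′))

meets-other-classes : ∀ {n} {S : Sub n} → Subtransversal S → ∣ S ∣ ≡ n ∸ 1 →
                      ∀ {v} → (∀ i → ¬ (S ∋ v , i)) → ∀ w → w ≢ v → ∃ λ j → S ∋ w , j
meets-other-classes {suc n} {S} S-st ∣S∣≡n {v} v∉S w w≢v with Fin.any? (S ∈? w)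
... | yes w∈S = w∈S
... | no  w∉S = contradiction (subst (λ m → 2 + m ≤ suc n) ∣S∣≡n
                  (∣∣+2≤n S (subtransversal⇒rowsAtMostOne {S = S} S-st) v w (w≢v ∘ sym)
                     (countRow-empty (lookup S v) v∉S) (countRow-empty (lookup S w) λ j j∈S → w∉S (j , j∈S))))
                  1+n≰n

subtransversal-index : ∀ {n} (X : Sub n) → Subtransversal X →
                       ∃ λ (τ : Fin n → Fin 3) → ∀ u k → X ∋ u , k → k ≡ τ u
subtransversal-index X (T , T-tr , X⊆T) = (λ u → proj₁ (T-tr u)) , λ u k k∈X → proj₂ (proj₂ (T-tr u)) k (X⊆T u k k∈X)

skew-pair-unique : ∀ {n} (X : Sub n) → ((v , i , j , _) : ExactlyOneSkewPair X) →
                   ∀ {u k l} → X ∋ u , k → X ∋ u , l → k ≢ l → u ≡ v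
skew-pair-unique X (_ , _ , _ , _ , _ , _ , unique) {u} {k} {l} k∈X l∈X k≢l with Fin.<-cmp k l
... | tri< k<l _ _ = proj₁ (unique u k l k<l k∈X l∈X)
... | tri≈ _ k≡l _ = contradiction k≡l k≢l
... | tri> _ _ l<k = proj₁ (unique u l k l<k l∈X k∈X)

Searchable : (B : Set) → (B → B → Set) → Set₁
Searchable B _≈_ = (P : B → Set) → (∀ {x y} → x ≈ y → P x → P y) → Decidable P → Dec (∃ P)

search-GF4 : Searchable GF4 _≡_
search-GF4 P _ P? = map′ witness (λ { (a , pa) → exhaust a pa }) (P? 𝟎 ⊎-dec P? 𝟏 ⊎-dec P? ω ⊎-dec P? ω²)
  where
  witness : P 𝟎 ⊎ P 𝟏 ⊎ P ω ⊎ P ω² → ∃ P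
  witness (inj₁ p)               = 𝟎 , p
  witness (inj₂ (inj₁ p))        = 𝟏 , p
  witness (inj₂ (inj₂ (inj₁ p))) = ω , p
  witness (inj₂ (inj₂ (inj₂ p))) = ω² , p
  exhaust : ∀ a → P a → P 𝟎 ⊎ P 𝟏 ⊎ P ω ⊎ P ω²
  exhaust 𝟎  p = inj₁ p
  exhaust 𝟏  p = inj₂ (inj₁ p)
  exhaust ω  p = inj₂ (inj₂ (inj₁ p))
  exhaust ω² p = inj₂ (inj₂ (inj₂ p))

search-Fin→ : ∀ {B _≈_} → (∀ {x} → x ≈ x) → Searchable B _≈_ →
              ∀ m → Searchable (Fin m → B) (λ f g → ∀ i → f i ≈ g i)
search-Fin→ ≈-refl search zero P resp P? =
  map′ (λ p → Vector.[] , p) (λ (f , p) → resp (λ ()) p) (P? Vector.[])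
search-Fin→ ≈-refl search (suc m) P resp P? =
  map′ (λ (b , f , p) → b Vector.∷ f , p)
       (λ (f , p) → f zero , f ∘ suc , resp (λ { zero → ≈-refl ; (suc i) → ≈-refl }) p)
       (search (λ b → ∃ λ f → P (b Vector.∷ f))
               (λ b≈b′ (f , p) → f , resp (λ { zero → b≈b′ ; (suc i) → ≈-refl }) p)
               (λ b → search-Fin→ ≈-refl search m (λ f → P (b Vector.∷ f))
                                  (λ f≈g → resp λ { zero → ≈-refl ; (suc i) → f≈g i })
                                  (λ f → P? (b Vector.∷ f))))

dot : ∀ {k} → (Fin k → GF4) → (Fin k → GF4) → GF4
dot r p = Σ₄ (λ t → r t *₄ p t)

Separated : ∀ {m k} → (Fin m → Fin k → GF4) → (Fin k → GF4) → Set
Separated {k = k} rows f = ∃ λ (p : Fin k → GF4) → (∀ i → dot (rows i) p ≡ 𝟎) × dot f p ≢ 𝟎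

InRowSpan : ∀ {m k} → (Fin m → Fin k → GF4) → (Fin k → GF4) → Set
InRowSpan {m} rows f = ∃ λ (λs : Fin m → GF4) → ∀ t → f t ≡ Σ₄ (λ i → λs i *₄ rows i t)

dot-cong : ∀ {k} {g g′ p : Fin k → GF4} → (∀ t → g t ≡ g′ t) → dot g p ≡ dot g′ p
dot-cong g≗g′ = Σ₄-cong (λ t → cong (_*₄ _) (g≗g′ t))

dot-linearˡ : ∀ {k} (g h : Fin k → GF4) c p → dot (λ t → g t +₄ c *₄ h t) p ≡ dot g p +₄ c *₄ dot h p
dot-linearˡ g h c p = begin
  Σ₄ (λ t → (g t +₄ c *₄ h t) *₄ p t)
    ≡⟨ Σ₄-cong (λ t → expand (g t) (h t) c (p t)) ⟩
  Σ₄ (λ t → g t *₄ p t +₄ c *₄ (h t *₄ p t))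
    ≡⟨ Σ₄-distrib-+₄ (λ t → g t *₄ p t) (λ t → c *₄ (h t *₄ p t)) ⟩
  dot g p +₄ Σ₄ (λ t → c *₄ (h t *₄ p t))
    ≡⟨ cong (dot g p +₄_) (*₄-distribˡ-Σ₄ c (λ t → h t *₄ p t)) ⟨
  dot g p +₄ c *₄ dot h p ∎
  where
  expand : ∀ a b c d → (a +₄ c *₄ b) *₄ d ≡ a *₄ d +₄ c *₄ (b *₄ d)
  expand = from-yes (all₄? λ a → all₄? λ b → all₄? λ c → all₄? λ d →
    (a +₄ c *₄ b) *₄ d ≟₄ a *₄ d +₄ c *₄ (b *₄ d))

dot-shift : ∀ {k} (g p : Fin k → GF4) μ j → dot g (λ t → p t +₄ μ *₄ δ t j) ≡ dot g p +₄ μ *₄ g j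
dot-shift g p μ j = begin
  Σ₄ (λ t → g t *₄ (p t +₄ μ *₄ δ t j))
    ≡⟨ Σ₄-cong (λ t → expand (g t) (p t) μ (δ t j)) ⟩
  Σ₄ (λ t → g t *₄ p t +₄ (μ *₄ g t) *₄ δ t j)
    ≡⟨ Σ₄-distrib-+₄ (λ t → g t *₄ p t) (λ t → (μ *₄ g t) *₄ δ t j) ⟩
  dot g p +₄ Σ₄ (λ t → (μ *₄ g t) *₄ δ t j)
    ≡⟨ cong (dot g p +₄_) (Σ₄-δ (λ t → μ *₄ g t) j) ⟩
  dot g p +₄ μ *₄ g j ∎
  where
  expand : ∀ a b c d → a *₄ (b +₄ c *₄ d) ≡ a *₄ b +₄ (c *₄ a) *₄ d
  expand = from-yes (all₄? λ a → all₄? λ b → all₄? λ c → all₄? λ d →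
    a *₄ (b +₄ c *₄ d) ≟₄ a *₄ b +₄ (c *₄ a) *₄ d)

-- One Gaussian elimination step: column j of the other rows and of f is cleared with the pivot row zero.
module Pivot {m k} (rows : Fin (suc m) → Fin k → GF4) (f : Fin k → GF4)
             (j : Fin k) (pivot≢0 : rows zero j ≢ 𝟎) where

  r₀ = rows zero

  factor : (Fin k → GF4) → GF4
  factor g = g j *₄ r₀ j ⁻¹

  clear : (Fin k → GF4) → Fin k → GF4
  clear g t = g t +₄ factor g *₄ r₀ t

  clear-j : ∀ g → clear g j ≡ 𝟎
  clear-j g = +₄-eliminate (g j) pivot≢0

  unclear : ∀ g t → g t ≡ clear g t +₄ factor g *₄ r₀ t
  unclear g t = sym (+₄-cancelʳ (g t) (factor g *₄ r₀ t))

  rows′ : Fin m → Fin k → GF4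
  rows′ i = clear (rows (suc i))

  span-lift : InRowSpan rows′ (clear f) → InRowSpan rows f
  span-lift (λs , f′≡) = λs₀ , expansion
    where
    μ : GF4
    μ = Σ₄ (λ i → λs i *₄ factor (rows (suc i)))

    λs₀ : Fin (suc m) → GF4
    λs₀ zero    = factor f +₄ μ
    λs₀ (suc i) = λs i

    expansion : ∀ t → f t ≡ Σ₄ (λ i → λs₀ i *₄ rows i t)
    expansion t = begin
      f t                                                               ≡⟨ unclear f t ⟩
      clear f t +₄ factor f *₄ r₀ t                                     ≡⟨ cong (_+₄ factor f *₄ r₀ t) (f′≡ t) ⟩
      Σ₄ (λ i → λs i *₄ rows′ i t) +₄ factor f *₄ r₀ t                  ≡⟨ cong (_+₄ factor f *₄ r₀ t) uncleared ⟩
      (Σ₄ (λ i → λs i *₄ rows (suc i) t) +₄ μ *₄ r₀ t) +₄ factor f *₄ r₀ t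
        ≡⟨ collect (Σ₄ (λ i → λs i *₄ rows (suc i) t)) μ (r₀ t) (factor f) ⟩
      λs₀ zero *₄ r₀ t +₄ Σ₄ (λ i → λs i *₄ rows (suc i) t)             ∎
      where
      expand : ∀ l a c b → l *₄ (a +₄ c *₄ b) ≡ l *₄ a +₄ (l *₄ c) *₄ b
      expand = from-yes (all₄? λ l → all₄? λ a → all₄? λ c → all₄? λ b →
        l *₄ (a +₄ c *₄ b) ≟₄ l *₄ a +₄ (l *₄ c) *₄ b)
      uncleared : Σ₄ (λ i → λs i *₄ rows′ i t) ≡ Σ₄ (λ i → λs i *₄ rows (suc i) t) +₄ μ *₄ r₀ t
      uncleared = begin
        Σ₄ (λ i → λs i *₄ rows′ i t)
          ≡⟨ Σ₄-cong (λ i → expand (λs i) (rows (suc i) t) (factor (rows (suc i))) (r₀ t)) ⟩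
        Σ₄ (λ i → λs i *₄ rows (suc i) t +₄ (λs i *₄ factor (rows (suc i))) *₄ r₀ t)
          ≡⟨ Σ₄-distrib-+₄ (λ i → λs i *₄ rows (suc i) t) (λ i → (λs i *₄ factor (rows (suc i))) *₄ r₀ t) ⟩
        Σ₄ (λ i → λs i *₄ rows (suc i) t) +₄ Σ₄ (λ i → (λs i *₄ factor (rows (suc i))) *₄ r₀ t)
          ≡⟨ cong (Σ₄ (λ i → λs i *₄ rows (suc i) t) +₄_) (*₄-distribʳ-Σ₄ (r₀ t) (λ i → λs i *₄ factor (rows (suc i)))) ⟨
        Σ₄ (λ i → λs i *₄ rows (suc i) t) +₄ μ *₄ r₀ t ∎
      collect : ∀ s l x c → (s +₄ l *₄ x) +₄ c *₄ x ≡ (c +₄ l) *₄ x +₄ s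
      collect = from-yes (all₄? λ s → all₄? λ l → all₄? λ x → all₄? λ c →
        (s +₄ l *₄ x) +₄ c *₄ x ≟₄ (c +₄ l) *₄ x +₄ s)

  separated-lift : Separated rows′ (clear f) → Separated rows f
  separated-lift (p , rows′⊥p , f′·p≢0) = p̃ , rows⊥p̃ , f′·p≢0 ∘ trans (sym (dot-clear f))
    where
    μ = dot r₀ p *₄ r₀ j ⁻¹
    p̃ : Fin k → GF4
    p̃ t = p t +₄ μ *₄ δ t j

    r₀⊥p̃ : dot r₀ p̃ ≡ 𝟎
    r₀⊥p̃ = trans (dot-shift r₀ p μ j) (+₄-eliminate (dot r₀ p) pivot≢0)

    -- adjusting p along e_j makes the first row irrelevant, and clearing leaves p unaffected
    dot-clear : ∀ g → dot g p̃ ≡ dot (clear g) p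
    dot-clear g = begin
      dot g p̃                                           ≡⟨ dot-cong (unclear g) ⟩
      dot (λ t → clear g t +₄ factor g *₄ r₀ t) p̃       ≡⟨ dot-linearˡ (clear g) r₀ (factor g) p̃ ⟩
      dot (clear g) p̃ +₄ factor g *₄ dot r₀ p̃           ≡⟨ cong (λ x → dot (clear g) p̃ +₄ factor g *₄ x) r₀⊥p̃ ⟩
      dot (clear g) p̃ +₄ factor g *₄ 𝟎                  ≡⟨ +₄-*₄-zeroʳ (dot (clear g) p̃) (factor g) ⟩
      dot (clear g) p̃                                   ≡⟨ dot-shift (clear g) p μ j ⟩
      dot (clear g) p +₄ μ *₄ clear g j                 ≡⟨ cong (λ x → dot (clear g) p +₄ μ *₄ x) (clear-j g) ⟩
      dot (clear g) p +₄ μ *₄ 𝟎                         ≡⟨ +₄-*₄-zeroʳ (dot (clear g) p) μ ⟩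
      dot (clear g) p                                   ∎

    rows⊥p̃ : ∀ i → dot (rows i) p̃ ≡ 𝟎
    rows⊥p̃ zero    = r₀⊥p̃
    rows⊥p̃ (suc i) = trans (dot-clear (rows (suc i))) (rows′⊥p i)

fredholm-alternative : ∀ {k} m (rows : Fin m → Fin k → GF4) f → Separated rows f ⊎ InRowSpan rows f
fredholm-alternative zero rows f with Fin.any? (λ t → ¬? (f t ≟₄ 𝟎))
... | yes (t , ft≢0) = inj₁ ((λ s → δ s t) , (λ ()) , ft≢0 ∘ trans (sym (Σ₄-δ f t)))
... | no  f≡0        = inj₂ ((λ ()) , λ t → ¬≢𝟎⇒≡𝟎 λ ft≢0 → f≡0 (t , ft≢0))
fredholm-alternative (suc m) rows f with Fin.any? (λ j → ¬? (rows zero j ≟₄ 𝟎))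
... | yes (j , pivot≢0) = Sum.map separated-lift span-lift (fredholm-alternative m rows′ (clear f))
  where open Pivot rows f j pivot≢0
... | no  r₀≡0 = Sum.map separated-lift span-lift (fredholm-alternative m (rows ∘ suc) f)
  where
  separated-lift : Separated (rows ∘ suc) f → Separated rows f
  separated-lift (p , rows⊥p , f·p≢0) = p , (λ where
    zero    → Σ₄-zeros _ λ t → cong (_*₄ p t) (¬≢𝟎⇒≡𝟎 λ r₀t≢0 → r₀≡0 (t , r₀t≢0))
    (suc i) → rows⊥p i) , f·p≢0
  span-lift : InRowSpan (rows ∘ suc) f → InRowSpan rows f
  span-lift (λs , f≡) = (λ { zero → 𝟎 ; (suc i) → λs i }) , f≡

Point : Set
Point = GF4 × GF4

-- The columns (v , 0), (v , 1), (v , 2) are e_v, A e_v and A e_v + e_v, so coefficients a at v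
-- contribute p A e_v + q e_v with (p , q) = coords a.
coords : (Fin 3 → GF4) → Point
coords a = a (suc zero) +₄ a (suc (suc zero)) , a zero +₄ a (suc (suc zero))

coords-cong : ∀ {a b} → (∀ i → a i ≡ b i) → coords a ≡ coords b
coords-cong a≗b = cong₂ _,_ (cong₂ _+₄_ (a≗b (suc zero)) (a≗b (suc (suc zero))))
                            (cong₂ _+₄_ (a≗b zero) (a≗b (suc (suc zero))))

form : Point → Point → GF4
form (p , q) (p′ , q′) = q *₄ inv p′ +₄ p *₄ inv q′

single : Fin 3 → GF4 → Fin 3 → GF4
single k α i = α *₄ δ i k

SupportedAt : (Fin 3 → GF4) → Fin 3 → Set
SupportedAt a k = ∀ i → i ≢ k → a i ≡ 𝟎

supported⇒single : ∀ {a k} → SupportedAt a k → ∀ i → a i ≡ single k (a k) i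
supported⇒single {a} {k} a-at-k i = by-cases (i Fin.≟ k)
  where
  by-cases : Dec (i ≡ k) → a i ≡ single k (a k) i
  by-cases (yes refl) = sym (trans (cong (a i *₄_) (δ-refl i)) (*₄-identityʳ (a i)))
  by-cases (no i≢k)   = trans (a-at-k i i≢k) (sym (trans (cong (a k *₄_) (δ-≢ i≢k)) (*₄-zeroʳ (a k))))

form-singles : ∀ k l α β →
               form (coords (single k α)) (coords (single l β)) ≡ (if does (k Fin.≟ l) then 𝟎 else α *₄ inv β)
form-singles = from-yes (Fin.all? λ k → Fin.all? λ l → all₄? λ α → all₄? λ β →
  form (coords (single k α)) (coords (single l β)) ≟₄ (if does (k Fin.≟ l) then 𝟎 else α *₄ inv β))

form-supported : ∀ {a b k l} → SupportedAt a k → SupportedAt b l →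
                 form (coords a) (coords b) ≡ (if does (k Fin.≟ l) then 𝟎 else a k *₄ inv (b l))
form-supported {a} {b} {k} {l} a-at-k b-at-l = begin
  form (coords a) (coords b)
    ≡⟨ cong₂ form (coords-cong (supported⇒single a-at-k)) (coords-cong (supported⇒single b-at-l)) ⟩
  form (coords (single k (a k))) (coords (single l (b l)))
    ≡⟨ form-singles k l (a k) (b l) ⟩
  (if does (k Fin.≟ l) then 𝟎 else a k *₄ inv (b l)) ∎

form-supported-≢𝟎⁻ : ∀ {a b k l} → SupportedAt a k → SupportedAt b l →
                     form (coords a) (coords b) ≢ 𝟎 → k ≢ l × a k ≢ 𝟎 × b l ≢ 𝟎
form-supported-≢𝟎⁻ {a} {b} {k} {l} a-at-k b-at-l form≢0 with k Fin.≟ l | form-supported a-at-k b-at-l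
... | yes _   | form≡0 = contradiction form≡0 form≢0
... | no  k≢l | form≡ = k≢l , (λ ak≡0 → form≢0 (trans form≡ (cong (_*₄ inv (b l)) ak≡0)))
                            , (λ bl≡0 → form≢0 (trans form≡ (trans (cong (λ x → a k *₄ inv x) bl≡0) (*₄-zeroʳ (a k)))))

form-supported-≢𝟎⁺ : ∀ {a b k l} → SupportedAt a k → SupportedAt b l →
                     k ≢ l → a k ≢ 𝟎 → b l ≢ 𝟎 → form (coords a) (coords b) ≢ 𝟎
form-supported-≢𝟎⁺ {a} {b} {k} {l} a-at-k b-at-l k≢l ak≢0 bl≢0 with k Fin.≟ l | form-supported a-at-k b-at-l
... | yes k≡l | _     = contradiction k≡l k≢l
... | no  _   | form≡ = *₄-nonzero ak≢0 (inv-nonzero bl≢0) ∘ trans (sym form≡)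

infixr 7 _*ᵥ_
_*ᵥ_ : ∀ {n} → Matrix n → (Fin n → GF4) → Fin n → GF4
(A *ᵥ p) u = Σ₄ (λ t → A u t *₄ p t)

graph : ∀ {n} → Matrix n → (Fin n → GF4) → Fin n → Point
graph A p u = p u , (A *ᵥ p) u

*ᵥ-self-adjoint : ∀ {n} {A : Matrix n} → InvSymmetric A → ∀ p p′ →
                  Σ₄ (λ u → (A *ᵥ p) u *₄ inv (p′ u)) ≡ Σ₄ (λ u → p u *₄ inv ((A *ᵥ p′) u))
*ᵥ-self-adjoint {A = A} A-sym p p′ = begin
  Σ₄ (λ u → (A *ᵥ p) u *₄ inv (p′ u))
    ≡⟨ Σ₄-cong (λ u → *₄-distribʳ-Σ₄ (inv (p′ u)) (λ t → A u t *₄ p t)) ⟩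
  Σ₄ (λ u → Σ₄ (λ t → (A u t *₄ p t) *₄ inv (p′ u)))
    ≡⟨ Σ₄-comm (λ u t → (A u t *₄ p t) *₄ inv (p′ u)) ⟩
  Σ₄ (λ t → Σ₄ (λ u → (A u t *₄ p t) *₄ inv (p′ u)))
    ≡⟨ Σ₄-cong (λ t → Σ₄-cong (λ u → entry t u)) ⟩
  Σ₄ (λ t → Σ₄ (λ u → p t *₄ inv (A t u *₄ p′ u)))
    ≡⟨ Σ₄-cong (λ t → sym (trans (cong (p t *₄_) (inv-Σ₄ (λ u → A t u *₄ p′ u)))
                                 (*₄-distribˡ-Σ₄ (p t) (λ u → inv (A t u *₄ p′ u))))) ⟩
  Σ₄ (λ u → p u *₄ inv ((A *ᵥ p′) u)) ∎
  where
  entry : ∀ t u → (A u t *₄ p t) *₄ inv (p′ u) ≡ p t *₄ inv (A t u *₄ p′ u)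
  entry t u = begin
    (A u t *₄ p t) *₄ inv (p′ u)       ≡⟨ rearrange (A u t) (p t) (inv (p′ u)) ⟩
    p t *₄ (A u t *₄ inv (p′ u))       ≡⟨ cong (λ x → p t *₄ (x *₄ inv (p′ u))) (A-sym u t) ⟨
    p t *₄ (inv (A t u) *₄ inv (p′ u)) ≡⟨ cong (p t *₄_) (inv-*₄ (A t u) (p′ u)) ⟨
    p t *₄ inv (A t u *₄ p′ u)         ∎
    where
    rearrange : ∀ a b c → (a *₄ b) *₄ c ≡ b *₄ (a *₄ c)
    rearrange = from-yes (all₄? λ a → all₄? λ b → all₄? λ c → (a *₄ b) *₄ c ≟₄ b *₄ (a *₄ c))

graph-isotropic : ∀ {n} {A : Matrix n} → InvSymmetric A → ∀ p p′ →
                  Σ₄ (λ u → form (graph A p u) (graph A p′ u)) ≡ 𝟎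
graph-isotropic {A = A} A-sym p p′ = begin
  Σ₄ (λ u → (A *ᵥ p) u *₄ inv (p′ u) +₄ p u *₄ inv ((A *ᵥ p′) u))
    ≡⟨ Σ₄-distrib-+₄ (λ u → (A *ᵥ p) u *₄ inv (p′ u)) (λ u → p u *₄ inv ((A *ᵥ p′) u)) ⟩
  Σ₄ (λ u → (A *ᵥ p) u *₄ inv (p′ u)) +₄ Σ₄ (λ u → p u *₄ inv ((A *ᵥ p′) u))
    ≡⟨ cong (_+₄ Σ₄ (λ u → p u *₄ inv ((A *ᵥ p′) u))) (*ᵥ-self-adjoint A-sym p p′) ⟩
  Σ₄ (λ u → p u *₄ inv ((A *ᵥ p′) u)) +₄ Σ₄ (λ u → p u *₄ inv ((A *ᵥ p′) u))
    ≡⟨ x+₄x≡𝟎 (Σ₄ (λ u → p u *₄ inv ((A *ᵥ p′) u))) ⟩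
  𝟎 ∎

SpannedBy : Fin 3 → Point → Set
SpannedBy k x = ∃ λ α → coords (single k α) ≡ x

spannedBy? : ∀ k x → Dec (SpannedBy k x)
spannedBy? k x = search-GF4 _ (λ { refl s → s }) λ α → ≡-dec _≟₄_ _≟₄_ (coords (single k α)) x

dir : Fin 3 → Point
dir k = coords (single k 𝟏)

-- Checked by exhaustion over GF(4); opaque so that the witnesses they produce are never unfolded.
opaque
  coords-single-𝟎 : ∀ k → coords (single k 𝟎) ≡ (𝟎 , 𝟎)
  coords-single-𝟎 = from-yes (Fin.all? λ k → ≡-dec _≟₄_ _≟₄_ (coords (single k 𝟎)) (𝟎 , 𝟎))

  spanned-isotropic : ∀ {k x} → SpannedBy k x → form x x ≡ 𝟎
  spanned-isotropic {k} (α , refl) = from-yes (Fin.all? λ k → all₄? λ α →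
    form (coords (single k α)) (coords (single k α)) ≟₄ 𝟎) k α

  isotropic⇒spanned : ∀ a b → form (a , b) (a , b) ≡ 𝟎 → ∃ λ k → SpannedBy k (a , b)
  isotropic⇒spanned = from-yes (all₄? λ a → all₄? λ b →
    (form (a , b) (a , b) ≟₄ 𝟎) →-dec Fin.any? λ k → spannedBy? k (a , b))

  normal⊥⇒spanned : ∀ k a b → proj₂ (dir k) *₄ a +₄ proj₁ (dir k) *₄ b ≡ 𝟎 → SpannedBy k (a , b)
  normal⊥⇒spanned = from-yes (Fin.all? λ k → all₄? λ a → all₄? λ b →
    (proj₂ (dir k) *₄ a +₄ proj₁ (dir k) *₄ b ≟₄ 𝟎) →-dec spannedBy? k (a , b))

  spanned-inv-dir : ∀ k l → SpannedBy k (inv (l *₄ proj₁ (dir k)) , inv (l *₄ proj₂ (dir k)))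
  spanned-inv-dir = from-yes (Fin.all? λ k → all₄? λ l →
    spannedBy? k (inv (l *₄ proj₁ (dir k)) , inv (l *₄ proj₂ (dir k))))

single-≢𝟎⇒≡ : ∀ {k α i} → single k α i ≢ 𝟎 → i ≡ k
single-≢𝟎⇒≡ {k} {α} {i} ≢0 = decidable-stable (i Fin.≟ k) λ i≢k →
  ≢0 (trans (cong (α *₄_) (δ-≢ i≢k)) (*₄-zeroʳ α))

single-self-≢𝟎 : ∀ {k α} → coords (single k α) ≢ (𝟎 , 𝟎) → single k α k ≢ 𝟎
single-self-≢𝟎 {k} {α} coords≢0 kk≡0 =
  coords≢0 (trans (cong (coords ∘ single k) α≡0) (coords-single-𝟎 k))
  where
  α≡0 : α ≡ 𝟎
  α≡0 = trans (sym (*₄-identityʳ α)) (trans (cong (α *₄_) (sym (δ-refl k))) kk≡0)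

module Columns {n : ℕ} (A : Matrix n) where

  Coef : Set
  Coef = Fin n → Fin 3 → GF4

  combination : Coef → Fin n → GF4
  combination c u = Σ₄ (λ v → Σ₄ (λ i → c v i *₄ column A v i u))

  IsRelation : Coef → Set
  IsRelation c = ∀ u → combination c u ≡ 𝟎

  Nontrivial : Coef → Set
  Nontrivial c = ∃₂ λ v i → c v i ≢ 𝟎

  support : Coef → Sub n
  support c = tabulate λ v → tabulate λ i → not (does (c v i ≟₄ 𝟎))

  lookup-support : ∀ c v i → lookup (lookup (support c) v) i ≡ not (does (c v i ≟₄ 𝟎))
  lookup-support c v i = trans (cong (λ r → lookup r i) (lookup∘tabulate _ v))
                               (lookup∘tabulate (λ i → not (does (c v i ≟₄ 𝟎))) i)

  ∈-support⁺ : ∀ c {v i} → c v i ≢ 𝟎 → support c ∋ v , i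
  ∈-support⁺ c {v} {i} cvi≢0 = trans (lookup-support c v i) (cong not (dec-false (c v i ≟₄ 𝟎) cvi≢0))

  ∈-support⁻ : ∀ c {v i} → support c ∋ v , i → c v i ≢ 𝟎
  ∈-support⁻ c {v} {i} ∈supp cvi≡0 with () ←
    trans (sym ∈supp) (trans (lookup-support c v i) (cong not (dec-true (c v i ≟₄ 𝟎) cvi≡0)))

  support-⊂ : ∀ {c d} → (∀ v i → d v i ≢ 𝟎 → c v i ≢ 𝟎) →
              ∀ {w j} → c w j ≢ 𝟎 → d w j ≡ 𝟎 → support d ⊂ support c
  support-⊂ {c} {d} d⊆c {w} {j} cwj≢0 dwj≡0 =
    (λ v i → ∈-support⁺ c ∘ d⊆c v i ∘ ∈-support⁻ d) , w , j , ∈-support⁺ c cwj≢0 , λ w∈d → ∈-support⁻ d w∈d dwj≡0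

  _+[_]_ : Coef → GF4 → Coef → Coef
  (c +[ k ] d) v i = c v i +₄ k *₄ d v i

  combination-+[] : ∀ c k d u → combination (c +[ k ] d) u ≡ combination c u +₄ k *₄ combination d u
  combination-+[] c k d u = begin
    Σ₄ (λ v → Σ₄ (λ i → (c v i +₄ k *₄ d v i) *₄ column A v i u))
      ≡⟨ Σ₄-cong (λ v → Σ₄-cong λ i → expand (c v i) (d v i) (column A v i u)) ⟩
    Σ₄ (λ v → Σ₄ (λ i → cᵤ v i +₄ k *₄ dᵤ v i))
      ≡⟨ Σ₄-cong (λ v → trans (Σ₄-distrib-+₄ (cᵤ v) (λ i → k *₄ dᵤ v i)) (cong (_ +₄_) (sym (*₄-distribˡ-Σ₄ k (dᵤ v))))) ⟩
    Σ₄ (λ v → Σ₄ (cᵤ v) +₄ k *₄ Σ₄ (dᵤ v))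
      ≡⟨ trans (Σ₄-distrib-+₄ (Σ₄ ∘ cᵤ) (λ v → k *₄ Σ₄ (dᵤ v))) (cong (_ +₄_) (sym (*₄-distribˡ-Σ₄ k (Σ₄ ∘ dᵤ)))) ⟩
    combination c u +₄ k *₄ combination d u ∎
    where
    cᵤ dᵤ : Fin n → Fin 3 → GF4
    cᵤ v i = c v i *₄ column A v i u
    dᵤ v i = d v i *₄ column A v i u
    expand : ∀ a b x → (a +₄ k *₄ b) *₄ x ≡ a *₄ x +₄ k *₄ (b *₄ x)
    expand a b x = from-yes (all₄? λ a → all₄? λ b → all₄? λ x → all₄? λ k →
      (a +₄ k *₄ b) *₄ x ≟₄ a *₄ x +₄ k *₄ (b *₄ x)) a b x k

  relation-+[] : ∀ c d → IsRelation c → IsRelation d → ∀ k → IsRelation (c +[ k ] d)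
  relation-+[] c d rel-c rel-d k u =
    trans (combination-+[] c k d u) (trans (cong₂ (λ a b → a +₄ k *₄ b) (rel-c u) (rel-d u)) (*₄-zeroʳ k))

  search-Coef : Searchable Coef (λ c d → ∀ v i → c v i ≡ d v i)
  search-Coef = search-Fin→ (λ _ → refl) (search-Fin→ refl search-GF4 3) n

  ProperSubrelation : Coef → Coef → Set
  ProperSubrelation c d = (∀ v i → d v i ≢ 𝟎 → c v i ≢ 𝟎) × Nontrivial d × IsRelation d ×
                          ∃₂ λ w j → c w j ≢ 𝟎 × d w j ≡ 𝟎

  proper-subrelation? : ∀ c → Dec (∃ (ProperSubrelation c))
  proper-subrelation? c = search-Coef (ProperSubrelation c) respects decide
    where
    respects : ∀ {d d′} → (∀ v i → d v i ≡ d′ v i) → ProperSubrelation c d → ProperSubrelation c d′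
    respects {d} {d′} d≗d′ (d⊆c , (v , i , dvi≢0) , rel , w , j , cwj≢0 , dwj≡0) =
      (λ v i d′≢0 → d⊆c v i (d′≢0 ∘ trans (sym (d≗d′ v i)))) ,
      (v , i , dvi≢0 ∘ trans (d≗d′ v i)) ,
      (λ u → trans (sym (Σ₄-cong λ v → Σ₄-cong λ i → cong (_*₄ column A v i u) (d≗d′ v i))) (rel u)) ,
      w , j , cwj≢0 , trans (sym (d≗d′ w j)) dwj≡0
    decide : ∀ d → Dec (ProperSubrelation c d)
    decide d = Fin.all? (λ v → Fin.all? λ i → ¬? (d v i ≟₄ 𝟎) →-dec ¬? (c v i ≟₄ 𝟎))
         ×-dec Fin.any? (λ v → Fin.any? λ i → ¬? (d v i ≟₄ 𝟎))
         ×-dec Fin.all? (λ u → combination d u ≟₄ 𝟎)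
         ×-dec Fin.any? (λ w → Fin.any? λ j → ¬? (c w j ≟₄ 𝟎) ×-dec d w j ≟₄ 𝟎)

  support-is-circuit : ∀ c → IsRelation c → Nontrivial c → ¬ ∃ (ProperSubrelation c) →
                       MCircuit A (support c)
  support-is-circuit c rel nontrivial minimal =
    (c , (λ v i → ∈-support⁺ c) , nontrivial , rel) , λ where
      Y (Y⊆supp , w , j , w∈supp , w∉Y) (d , d⊆Y , nontrivial-d , rel-d) →
        minimal (d , (λ v i → ∈-support⁻ c ∘ Y⊆supp v i ∘ d⊆Y v i) , nontrivial-d , rel-d ,
                 w , j , ∈-support⁻ c w∈supp , ¬≢𝟎⇒≡𝟎 (w∉Y ∘ d⊆Y w j))

  -- Cancelling a coordinate of c by a multiple of d keeps (v , i) when d vanishes there.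
  shrink-relation : ∀ c → IsRelation c → ∀ {v i} → c v i ≢ 𝟎 → ∃ (ProperSubrelation c) →
                    ∃ λ c′ → IsRelation c′ × c′ v i ≢ 𝟎 × support c′ ⊂ support c
  shrink-relation c rel {v} {i} cvi≢0 (d , d⊆c , (w , j , dwj≢0) , rel-d , w′ , j′ , cw′j′≢0 , dw′j′≡0)
    with d v i ≟₄ 𝟎
  ... | no dvi≢0 = d , rel-d , dvi≢0 , support-⊂ d⊆c cw′j′≢0 dw′j′≡0
  ... | yes dvi≡0 = c +[ κ ] d , relation-+[] c d rel rel-d κ , c′vi≢0 ,
                    support-⊂ c′⊆c (d⊆c w j dwj≢0) (+₄-eliminate (c w j) dwj≢0)
    where
    κ = c w j *₄ d w j ⁻¹
    c′vi≢0 : c v i +₄ κ *₄ d v i ≢ 𝟎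
    c′vi≢0 = cvi≢0 ∘ trans (sym (trans (cong (λ x → c v i +₄ κ *₄ x) dvi≡0) (+₄-*₄-zeroʳ (c v i) κ)))
    c′⊆c : ∀ x y → c x y +₄ κ *₄ d x y ≢ 𝟎 → c x y ≢ 𝟎
    c′⊆c x y c′≢0 cxy≡0 = c′≢0 (trans (cong₂ (λ a b → a +₄ κ *₄ b) cxy≡0 dxy≡0) (*₄-zeroʳ κ))
      where
      dxy≡0 : d x y ≡ 𝟎
      dxy≡0 = ¬≢𝟎⇒≡𝟎 λ dxy≢0 → d⊆c x y dxy≢0 cxy≡0

  circuit-through : ∀ c → IsRelation c → ∀ {v i} → c v i ≢ 𝟎 →
                    ∃ λ C → MCircuit A C × C ⊆ support c × C ∋ v , i
  circuit-through c rel = go c rel (<-wellFounded ∣ support c ∣)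
    where
    go : ∀ c → IsRelation c → Acc _<_ ∣ support c ∣ → ∀ {v i} → c v i ≢ 𝟎 →
         ∃ λ C → MCircuit A C × C ⊆ support c × C ∋ v , i
    go c rel (acc smaller) {v} {i} cvi≢0 with proper-subrelation? c
    ... | no minimal = support c , support-is-circuit c rel (v , i , cvi≢0) minimal ,
                       (λ _ _ j∈C → j∈C) , ∈-support⁺ c cvi≢0
    ... | yes sub =
      let (c′ , rel′ , c′vi≢0 , c′⊂c) = shrink-relation c rel cvi≢0 sub
          (C , C-circuit , C⊆c′ , v∈C) = go c′ rel′ (smaller (∣∣-mono-⊂ (support c′) (support c) c′⊂c)) c′vi≢0
      in C , C-circuit , (λ w j → proj₁ c′⊂c w j ∘ C⊆c′ w j) , v∈C

  ¬dependent-∅ : ¬ Dependent A ∅ₛ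
  ¬dependent-∅ (c , c⊆∅ , (v , i , cvi≢0) , _) = ∉∅ v i (c⊆∅ v i cvi≢0)

  circuit-support : ∀ {C} → MCircuit A C → ∀ c → (∀ v i → c v i ≢ 𝟎 → C ∋ v , i) →
                    Nontrivial c → IsRelation c → ∀ {v i} → C ∋ v , i → c v i ≢ 𝟎
  circuit-support (_ , minimal) c c⊆C nontrivial rel {v} {i} v∈C cvi≡0 =
    minimal (support c) ((λ w j → c⊆C w j ∘ ∈-support⁻ c) , v , i , v∈C , λ v∈c → ∈-support⁻ c v∈c cvi≡0)
            (c , (λ w j → ∈-support⁺ c) , nontrivial , rel)

  circuit-⊆⇒≡ : ∀ {C₁ C₂} → MCircuit A C₁ → MCircuit A C₂ → C₁ ⊆ C₂ → C₁ ≡ C₂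
  circuit-⊆⇒≡ {C₁} {C₂} (dep₁ , _) (_ , minimal₂) C₁⊆C₂ = ⊆-antisym C₁⊆C₂ C₂⊆C₁
    where
    C₂⊆C₁ : C₂ ⊆ C₁
    C₂⊆C₁ v i v∈C₂ with (C₁ ∈? v) i
    ... | yes v∈C₁ = v∈C₁
    ... | no  v∉C₁ = contradiction dep₁ (minimal₂ C₁ (C₁⊆C₂ , v , i , v∈C₂ , v∉C₁))

  circuit-elimination : ∀ {C₁ C₂} → MCircuit A C₁ → MCircuit A C₂ → C₁ ≢ C₂ →
                        ∀ {v i} → C₁ ∋ v , i → C₂ ∋ v , i →
                        ∃ λ C₃ → MCircuit A C₃ × C₃ ⊆ remove (C₁ ∪ C₂) v i
  circuit-elimination {C₁} {C₂} circuit₁@((c₁ , c₁⊆C₁ , nt₁ , rel₁) , _) circuit₂@((c₂ , c₂⊆C₂ , nt₂ , rel₂) , _)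
                      C₁≢C₂ {v} {i} v∈C₁ v∈C₂ =
    eliminate (Fin.any? λ w → Fin.any? λ j → ¬? (d w j ≟₄ 𝟎))
    where
    κ = c₁ v i *₄ c₂ v i ⁻¹
    d = c₁ +[ κ ] c₂

    d≡0⇒c₁≡0 : ∀ {x y} → d x y ≡ 𝟎 → c₂ x y ≡ 𝟎 → c₁ x y ≡ 𝟎
    d≡0⇒c₁≡0 {x} {y} dxy≡0 c₂xy≡0 = trans (sym (+₄-cancelʳ (c₁ x y) (κ *₄ c₂ x y)))
      (trans (cong₂ (λ a b → a +₄ κ *₄ b) dxy≡0 c₂xy≡0) (*₄-zeroʳ κ))

    d⊆C₁∪C₂ : ∀ x y → d x y ≢ 𝟎 → (C₁ ∪ C₂) ∋ x , y
    d⊆C₁∪C₂ x y dxy≢0 with c₁ x y ≟₄ 𝟎 | c₂ x y ≟₄ 𝟎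
    ... | no c₁≢0  | _        = ∈-∪⁺ˡ C₁ C₂ (c₁⊆C₁ x y c₁≢0)
    ... | yes _    | no c₂≢0  = ∈-∪⁺ʳ C₁ C₂ (c₂⊆C₂ x y c₂≢0)
    ... | yes c₁≡0 | yes c₂≡0 =
      contradiction (trans (cong₂ (λ a b → a +₄ κ *₄ b) c₁≡0 c₂≡0) (*₄-zeroʳ κ)) dxy≢0

    d⊆removal : ∀ x y → d x y ≢ 𝟎 → remove (C₁ ∪ C₂) v i ∋ x , y
    d⊆removal x y dxy≢0 = ∈-remove⁺ (C₁ ∪ C₂) v i (d⊆C₁∪C₂ x y dxy≢0) λ where
      (refl , refl) → dxy≢0 (+₄-eliminate (c₁ v i) (circuit-support {C₂} circuit₂ c₂ c₂⊆C₂ nt₂ rel₂ v∈C₂))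

    eliminate : Dec (Nontrivial d) → ∃ λ C₃ → MCircuit A C₃ × C₃ ⊆ remove (C₁ ∪ C₂) v i
    eliminate (yes (w , j , dwj≢0)) =
      let (C₃ , C₃-circuit , C₃⊆d , _) = circuit-through d (relation-+[] c₁ c₂ rel₁ rel₂ κ) dwj≢0
      in C₃ , C₃-circuit , λ x y → d⊆removal x y ∘ ∈-support⁻ d ∘ C₃⊆d x y
    eliminate (no d≡0) = contradiction (circuit-⊆⇒≡ circuit₁ circuit₂ C₁⊆C₂) C₁≢C₂
      where
      C₁⊆C₂ : C₁ ⊆ C₂
      C₁⊆C₂ x y x∈C₁ with c₂ x y ≟₄ 𝟎
      ... | no c₂≢0  = c₂⊆C₂ x y c₂≢0
      ... | yes c₂≡0 = contradiction (d≡0⇒c₁≡0 (¬≢𝟎⇒≡𝟎 λ dxy≢0 → d≡0 (x , y , dxy≢0)) c₂≡0)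
                                     (circuit-support {C₁} circuit₁ c₁ c₁⊆C₁ nt₁ rel₁ x∈C₁)

  pCoord : Coef → Fin n → GF4
  pCoord c = proj₁ ∘ coords ∘ c

  combination≡ : ∀ c u → combination c u ≡ proj₂ (coords (c u)) +₄ (A *ᵥ pCoord c) u
  combination≡ c u = begin
    combination c u
      ≡⟨ Σ₄-cong (λ v → trans (cong (λ d → Σ₄ (λ i → c v i *₄ column′ d v i)) (δ-sym u v))
                              (expand (c v zero) (c v (suc zero)) (c v (suc (suc zero))) (δ v u) (A u v))) ⟩
    Σ₄ (λ v → proj₂ (coords (c v)) *₄ δ v u +₄ A u v *₄ pCoord c v)
      ≡⟨ Σ₄-distrib-+₄ (λ v → proj₂ (coords (c v)) *₄ δ v u) (λ v → A u v *₄ pCoord c v) ⟩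
    Σ₄ (λ v → proj₂ (coords (c v)) *₄ δ v u) +₄ (A *ᵥ pCoord c) u
      ≡⟨ cong (_+₄ (A *ᵥ pCoord c) u) (Σ₄-δ (proj₂ ∘ coords ∘ c) u) ⟩
    proj₂ (coords (c u)) +₄ (A *ᵥ pCoord c) u ∎
    where
    column′ : GF4 → Fin n → Fin 3 → GF4
    column′ d v zero             = d
    column′ d v (suc zero)       = A u v
    column′ d v (suc (suc zero)) = A u v +₄ d
    expand : ∀ c₀ c₁ c₂ d a → c₀ *₄ d +₄ (c₁ *₄ a +₄ (c₂ *₄ (a +₄ d) +₄ 𝟎)) ≡
                                (c₀ +₄ c₂) *₄ d +₄ a *₄ (c₁ +₄ c₂)
    expand = from-yes (all₄? λ c₀ → all₄? λ c₁ → all₄? λ c₂ → all₄? λ d → all₄? λ a →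
      c₀ *₄ d +₄ (c₁ *₄ a +₄ (c₂ *₄ (a +₄ d) +₄ 𝟎)) ≟₄ (c₀ +₄ c₂) *₄ d +₄ a *₄ (c₁ +₄ c₂))

  relation⇒coords≡graph : ∀ c → IsRelation c → ∀ u → coords (c u) ≡ graph A (pCoord c) u
  relation⇒coords≡graph c rel u =
    cong (pCoord c u ,_) (+₄≡𝟎⇒≡ (trans (sym (combination≡ c u)) (rel u)))

  relations-orthogonal : InvSymmetric A → ∀ c c′ → IsRelation c → IsRelation c′ →
                         Σ₄ (λ u → form (coords (c u)) (coords (c′ u))) ≡ 𝟎
  relations-orthogonal A-sym c c′ rel rel′ =
    trans (Σ₄-cong λ u → cong₂ form (relation⇒coords≡graph c rel u) (relation⇒coords≡graph c′ rel′ u))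
          (graph-isotropic A-sym (pCoord c) (pCoord c′))

  graph⇒relation : ∀ c p → (∀ u → coords (c u) ≡ graph A p u) → IsRelation c
  graph⇒relation c p c≡graph u = begin
    combination c u                           ≡⟨ combination≡ c u ⟩
    proj₂ (coords (c u)) +₄ (A *ᵥ pCoord c) u ≡⟨ cong₂ _+₄_ (cong proj₂ (c≡graph u))
                                                          (Σ₄-cong λ t → cong (A u t *₄_) (cong proj₁ (c≡graph t))) ⟩
    (A *ᵥ p) u +₄ (A *ᵥ p) u                  ≡⟨ x+₄x≡𝟎 ((A *ᵥ p) u) ⟩
    𝟎                                         ∎

Z : ∀ {n} → Matrix n → Family n
Z A X = Subtransversal X × MCircuit A X

module _ {n : ℕ} (A : Matrix n) where
  open Columns A

  M-shelters-Z : ShelteredBy (MCircuit A) (Z A)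
  M-shelters-Z T T-tr X = (λ (X⊆T , _ , circuit) → X⊆T , circuit) ,
                          (λ (X⊆T , circuit) → X⊆T , (T , T-tr , X⊆T) , circuit)

  Z-restriction-isMatroid : ∀ T → Transversal T → IsMatroidByCircuits T (restrict (Z A) T)
  Z-restriction-isMatroid T T-tr =
    (λ _ → proj₁) , (λ (_ , _ , dep , _) → ¬dependent-∅ dep) ,
    (λ _ _ (_ , _ , circuit₁) (_ , _ , circuit₂) → circuit-⊆⇒≡ circuit₁ circuit₂) ,
    elimination
    where
    elimination : ∀ C₁ C₂ → restrict (Z A) T C₁ → restrict (Z A) T C₂ → C₁ ≢ C₂ →
                  ∀ v i → C₁ ∋ v , i → C₂ ∋ v , i →
                  Σ _ λ C₃ → restrict (Z A) T C₃ × C₃ ⊆ remove (C₁ ∪ C₂) v i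
    elimination C₁ C₂ (C₁⊆T , _ , circuit₁) (C₂⊆T , _ , circuit₂) C₁≢C₂ v i v∈C₁ v∈C₂ =
      let (C₃ , circuit₃ , C₃⊆) = circuit-elimination circuit₁ circuit₂ C₁≢C₂ v∈C₁ v∈C₂
          C₃⊆T : C₃ ⊆ T
          C₃⊆T w j j∈C₃ = [ C₁⊆T w j , C₂⊆T w j ]′ (∈-∪⁻ C₁ C₂ (∈-remove⁻ (C₁ ∪ C₂) v i (C₃⊆ w j j∈C₃)))
      in C₃ , (C₃⊆T , (T , T-tr , C₃⊆T) , circuit₃) , C₃⊆

  Z-isSemiMultimatroid : IsSemiMultimatroid (Z A)
  Z-isSemiMultimatroid = (λ _ → proj₁) , Z-restriction-isMatroid

module InvSymmetricMatrix {n : ℕ} {A : Matrix n} (A-sym : InvSymmetric A) where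
  open Columns A

  Z-noSingleSkewPair : ∀ C₁ C₂ → Z A C₁ → Z A C₂ → ¬ ExactlyOneSkewPair (C₁ ∪ C₂)
  Z-noSingleSkewPair C₁ C₂ (st₁ , circuit₁@((c₁ , c₁⊆C₁ , nt₁ , rel₁) , _))
                           (st₂ , circuit₂@((c₂ , c₂⊆C₂ , nt₂ , rel₂) , _))
                     pair@(v , i , j , i<j , i∈C , j∈C , _) =
    form≢0 (trans (sym (Σ₄-supported-at local v off-v)) (relations-orthogonal A-sym c₁ c₂ rel₁ rel₂))
    where
    τ₁ = proj₁ (subtransversal-index C₁ st₁)
    τ₂ = proj₁ (subtransversal-index C₂ st₂)
    index₁ = proj₂ (subtransversal-index C₁ st₁)
    index₂ = proj₂ (subtransversal-index C₂ st₂)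

    local : Fin n → GF4
    local u = form (coords (c₁ u)) (coords (c₂ u))

    c₁-at : ∀ u → SupportedAt (c₁ u) (τ₁ u)
    c₁-at u k k≢τ = ¬≢𝟎⇒≡𝟎 (k≢τ ∘ index₁ u k ∘ c₁⊆C₁ u k)
    c₂-at : ∀ u → SupportedAt (c₂ u) (τ₂ u)
    c₂-at u k k≢τ = ¬≢𝟎⇒≡𝟎 (k≢τ ∘ index₂ u k ∘ c₂⊆C₂ u k)

    off-v : ∀ u → u ≢ v → local u ≡ 𝟎
    off-v u u≢v = ¬≢𝟎⇒≡𝟎 λ local≢0 →
      let (τ₁≢τ₂ , c₁≢0 , c₂≢0) = form-supported-≢𝟎⁻ (c₁-at u) (c₂-at u) local≢0
      in u≢v (skew-pair-unique (C₁ ∪ C₂) pair (∈-∪⁺ˡ C₁ C₂ (c₁⊆C₁ u _ c₁≢0)) (∈-∪⁺ʳ C₁ C₂ (c₂⊆C₂ u _ c₂≢0)) τ₁≢τ₂)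

    -- each circuit meets the class of v at most once, so the skew pair is split between them
    split : ∃₂ λ k l → C₁ ∋ v , k × C₂ ∋ v , l × k ≢ l
    split with ∈-∪⁻ C₁ C₂ i∈C | ∈-∪⁻ C₁ C₂ j∈C
    ... | inj₁ i∈C₁ | inj₁ j∈C₁ = contradiction (trans (index₁ v i i∈C₁) (sym (index₁ v j j∈C₁))) (Fin.<⇒≢ i<j)
    ... | inj₂ i∈C₂ | inj₂ j∈C₂ = contradiction (trans (index₂ v i i∈C₂) (sym (index₂ v j j∈C₂))) (Fin.<⇒≢ i<j)
    ... | inj₁ i∈C₁ | inj₂ j∈C₂ = i , j , i∈C₁ , j∈C₂ , Fin.<⇒≢ i<j
    ... | inj₂ i∈C₂ | inj₁ j∈C₁ = j , i , j∈C₁ , i∈C₂ , Fin.<⇒≢ i<j ∘ sym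

    form≢0 : local v ≢ 𝟎
    form≢0 =
      let (k , l , k∈C₁ , l∈C₂ , k≢l) = split
          k≡τ₁ = index₁ v k k∈C₁
          l≡τ₂ = index₂ v l l∈C₂
      in form-supported-≢𝟎⁺ (c₁-at v) (c₂-at v)
           (λ τ₁≡τ₂ → k≢l (trans k≡τ₁ (trans τ₁≡τ₂ (sym l≡τ₂))))
           (subst (λ x → c₁ v x ≢ 𝟎) k≡τ₁ (circuit-support {C₁} circuit₁ c₁ c₁⊆C₁ nt₁ rel₁ k∈C₁))
           (subst (λ x → c₂ v x ≢ 𝟎) l≡τ₂ (circuit-support {C₂} circuit₂ c₂ c₂⊆C₂ nt₂ rel₂ l∈C₂))

  Z-isMultimatroid : IsMultimatroid (Z A)
  Z-isMultimatroid = Z-isSemiMultimatroid A , Z-noSingleSkewPair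

  Admissible : (Fin n → Fin 3) → Fin n → Set
  Admissible τ v = ∃ λ p → (∀ w → w ≢ v → SpannedBy (τ w) (graph A p w)) × graph A p v ≢ (𝟎 , 𝟎)

  module Constraints (τ : Fin n → Fin 3) (v : Fin n) where
    mask : Fin n → GF4
    mask w = 𝟏 +₄ δ w v

    mask-v : mask v ≡ 𝟎
    mask-v = cong (𝟏 +₄_) (δ-refl v)

    mask-≢ : ∀ {w} → w ≢ v → mask w ≡ 𝟏
    mask-≢ w≢v = cong (𝟏 +₄_) (δ-≢ w≢v)

    a b : Fin n → GF4
    a w = mask w *₄ proj₂ (dir (τ w))
    b w = mask w *₄ proj₁ (dir (τ w))

    -- row w ⊥ p says that graph A p w lies on the line of kind τ w; the mask makes row v zero.
    row : Fin n → Fin n → GF4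
    row w t = a w *₄ δ w t +₄ b w *₄ A w t

    dot-row : ∀ w p → dot (row w) p ≡ a w *₄ p w +₄ b w *₄ (A *ᵥ p) w
    dot-row w p = begin
      Σ₄ (λ t → (a w *₄ δ w t +₄ b w *₄ A w t) *₄ p t)
        ≡⟨ Σ₄-cong (λ t → trans (cong (λ d → (a w *₄ d +₄ b w *₄ A w t) *₄ p t) (δ-sym w t))
                                (expand (a w) (δ t w) (b w) (A w t) (p t))) ⟩
      Σ₄ (λ t → a w *₄ (p t *₄ δ t w) +₄ b w *₄ (A w t *₄ p t))
        ≡⟨ Σ₄-distrib-+₄ (λ t → a w *₄ (p t *₄ δ t w)) (λ t → b w *₄ (A w t *₄ p t)) ⟩
      Σ₄ (λ t → a w *₄ (p t *₄ δ t w)) +₄ Σ₄ (λ t → b w *₄ (A w t *₄ p t))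
        ≡⟨ cong₂ _+₄_ (trans (cong (a w *₄_) (sym (Σ₄-δ p w))) (*₄-distribˡ-Σ₄ (a w) (λ t → p t *₄ δ t w)))
                      (*₄-distribˡ-Σ₄ (b w) (λ t → A w t *₄ p t)) ⟨
      a w *₄ p w +₄ b w *₄ (A *ᵥ p) w ∎
      where
      expand : ∀ a d b x q → (a *₄ d +₄ b *₄ x) *₄ q ≡ a *₄ (q *₄ d) +₄ b *₄ (x *₄ q)
      expand = from-yes (all₄? λ a → all₄? λ d → all₄? λ b → all₄? λ x → all₄? λ q →
        (a *₄ d +₄ b *₄ x) *₄ q ≟₄ a *₄ (q *₄ d) +₄ b *₄ (x *₄ q))

    row⊥⇒spanned : ∀ p {w} → w ≢ v → dot (row w) p ≡ 𝟎 → SpannedBy (τ w) (graph A p w)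
    row⊥⇒spanned p {w} w≢v row⊥p = normal⊥⇒spanned (τ w) (p w) ((A *ᵥ p) w) (begin
      proj₂ (dir (τ w)) *₄ p w +₄ proj₁ (dir (τ w)) *₄ (A *ᵥ p) w
        ≡⟨ cong₂ (λ m m′ → m *₄ proj₂ (dir (τ w)) *₄ p w +₄ m′ *₄ proj₁ (dir (τ w)) *₄ (A *ᵥ p) w)
                 (mask-≢ w≢v) (mask-≢ w≢v) ⟨
      a w *₄ p w +₄ b w *₄ (A *ᵥ p) w
        ≡⟨ trans (sym (dot-row w p)) row⊥p ⟩
      𝟎 ∎)

    eᵥ : Fin n → GF4
    eᵥ t = δ t v

    separated⇒admissible : Separated row eᵥ → Admissible τ v
    separated⇒admissible (p , rows⊥p , eᵥ·p≢0) =
      p , (λ w w≢v → row⊥⇒spanned p w≢v (rows⊥p w)) ,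
      λ graph≡0 → eᵥ·p≢0 (begin
        Σ₄ (λ t → δ t v *₄ p t) ≡⟨ Σ₄-cong (λ t → *₄-comm (δ t v) (p t)) ⟩
        Σ₄ (λ t → p t *₄ δ t v) ≡⟨ Σ₄-δ p v ⟩
        p v                     ≡⟨ cong proj₁ graph≡0 ⟩
        𝟎                       ∎)

    -- If eᵥ = Σ λs w · row w, then p t = inv (λs t · b t) is the required vector: by inv-symmetry
    -- A p is inv of the combination of the A-parts of the rows.
    span⇒admissible : InRowSpan row eᵥ → Admissible τ v
    span⇒admissible (λs , eᵥ≡) = p , spanned , λ graph≡0 → case trans (sym Ap-v) (cong proj₂ graph≡0) of λ ()
      where
      x p : Fin n → GF4
      x w = λs w *₄ b w
      p t = inv (x t)

      xA≡ : ∀ s → Σ₄ (λ w → x w *₄ A w s) ≡ δ s v +₄ λs s *₄ a s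
      xA≡ s = begin
        Σ₄ (λ w → x w *₄ A w s)
          ≡⟨ swap-cancel (λs s *₄ a s) _ ⟩
        (λs s *₄ a s +₄ Σ₄ (λ w → x w *₄ A w s)) +₄ λs s *₄ a s
          ≡⟨ cong (_+₄ λs s *₄ a s) (Σ-expansion s) ⟨
        Σ₄ (λ w → λs w *₄ row w s) +₄ λs s *₄ a s
          ≡⟨ cong (_+₄ λs s *₄ a s) (eᵥ≡ s) ⟨
        δ s v +₄ λs s *₄ a s ∎
        where
        swap-cancel : ∀ c d → d ≡ (c +₄ d) +₄ c
        swap-cancel = from-yes (all₄? λ c → all₄? λ d → d ≟₄ (c +₄ d) +₄ c)
        Σ-expansion : ∀ s → Σ₄ (λ w → λs w *₄ row w s) ≡ λs s *₄ a s +₄ Σ₄ (λ w → x w *₄ A w s)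
        Σ-expansion s = begin
          Σ₄ (λ w → λs w *₄ (a w *₄ δ w s +₄ b w *₄ A w s))
            ≡⟨ Σ₄-cong (λ w → expand (λs w) (a w) (δ w s) (b w) (A w s)) ⟩
          Σ₄ (λ w → (λs w *₄ a w) *₄ δ w s +₄ x w *₄ A w s)
            ≡⟨ Σ₄-distrib-+₄ (λ w → (λs w *₄ a w) *₄ δ w s) (λ w → x w *₄ A w s) ⟩
          Σ₄ (λ w → (λs w *₄ a w) *₄ δ w s) +₄ Σ₄ (λ w → x w *₄ A w s)
            ≡⟨ cong (_+₄ Σ₄ (λ w → x w *₄ A w s)) (Σ₄-δ (λ w → λs w *₄ a w) s) ⟩
          λs s *₄ a s +₄ Σ₄ (λ w → x w *₄ A w s) ∎
          where
          expand : ∀ l a d b y → l *₄ (a *₄ d +₄ b *₄ y) ≡ (l *₄ a) *₄ d +₄ (l *₄ b) *₄ y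
          expand = from-yes (all₄? λ l → all₄? λ a → all₄? λ d → all₄? λ b → all₄? λ y →
            l *₄ (a *₄ d +₄ b *₄ y) ≟₄ (l *₄ a) *₄ d +₄ (l *₄ b) *₄ y)

      Ap≡ : ∀ s → (A *ᵥ p) s ≡ inv (δ s v +₄ λs s *₄ a s)
      Ap≡ s = begin
        Σ₄ (λ t → A s t *₄ inv (x t))
          ≡⟨ Σ₄-cong (λ t → trans (cong (_*₄ inv (x t)) (sym (A-sym s t)))
                                  (trans (sym (inv-*₄ (A t s) (x t))) (cong inv (*₄-comm (A t s) (x t))))) ⟩
        Σ₄ (λ t → inv (x t *₄ A t s))
          ≡⟨ inv-Σ₄ (λ t → x t *₄ A t s) ⟨
        inv (Σ₄ (λ t → x t *₄ A t s))
          ≡⟨ cong inv (xA≡ s) ⟩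
        inv (δ s v +₄ λs s *₄ a s) ∎

      Ap-v : (A *ᵥ p) v ≡ 𝟏
      Ap-v = begin
        (A *ᵥ p) v                                            ≡⟨ Ap≡ v ⟩
        inv (δ v v +₄ λs v *₄ (mask v *₄ proj₂ (dir (τ v))))
          ≡⟨ cong₂ (λ d m → inv (d +₄ λs v *₄ (m *₄ _))) (δ-refl v) mask-v ⟩
        inv (𝟏 +₄ λs v *₄ 𝟎)                                  ≡⟨ cong inv (+₄-*₄-zeroʳ 𝟏 (λs v)) ⟩
        𝟏                                                     ∎

      Ap-w : ∀ {w} → w ≢ v → (A *ᵥ p) w ≡ inv (λs w *₄ proj₂ (dir (τ w)))
      Ap-w {w} w≢v = begin
        (A *ᵥ p) w                                            ≡⟨ Ap≡ w ⟩
        inv (δ w v +₄ λs w *₄ (mask w *₄ proj₂ (dir (τ w))))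
          ≡⟨ cong₂ (λ d m → inv (d +₄ λs w *₄ (m *₄ _))) (δ-≢ w≢v) (mask-≢ w≢v) ⟩
        inv (λs w *₄ proj₂ (dir (τ w)))                       ∎

      spanned : ∀ w → w ≢ v → SpannedBy (τ w) (graph A p w)
      spanned w w≢v = subst (SpannedBy (τ w)) (cong₂ _,_ p-w (sym (Ap-w w≢v))) (spanned-inv-dir (τ w) (λs w))
        where
        p-w : inv (λs w *₄ proj₁ (dir (τ w))) ≡ p w
        p-w = cong (λ m → inv (λs w *₄ (m *₄ proj₁ (dir (τ w))))) (sym (mask-≢ w≢v))

  -- opaque: p is only ever used through Admissible, and unfolding it makes type checking explode
  opaque
    admissible-vector : ∀ τ v → Admissible τ v
    admissible-vector τ v = [ separated⇒admissible , span⇒admissible ]′ (fredholm-alternative n row eᵥ)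
      where open Constraints τ v

  -- the form vanishes on the graph of p, and at every w ≢ v it vanishes locally, hence also at v
  spanned-at-v : ∀ {τ : Fin n → Fin 3} {v} p → (∀ w → w ≢ v → SpannedBy (τ w) (graph A p w)) →
                 ∃ λ x → SpannedBy x (graph A p v)
  spanned-at-v {τ} {v} p spanned = isotropic⇒spanned (p v) ((A *ᵥ p) v) (begin
    form (graph A p v) (graph A p v)
      ≡⟨ Σ₄-supported-at (λ u → form (graph A p u) (graph A p u)) v (λ w w≢v → spanned-isotropic {τ w} (spanned w w≢v)) ⟨
    Σ₄ (λ u → form (graph A p u) (graph A p u))
      ≡⟨ graph-isotropic A-sym p p ⟩
    𝟎 ∎)

  relation-on-lines : ∀ (κ : Fin n → Fin 3) p → (∀ w → SpannedBy (κ w) (graph A p w)) →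
                      ∃ λ c → IsRelation c × (∀ w i → c w i ≢ 𝟎 → i ≡ κ w) ×
                              (∀ w → graph A p w ≢ (𝟎 , 𝟎) → c w (κ w) ≢ 𝟎)
  relation-on-lines κ p spanned =
    c , graph⇒relation c p (proj₂ ∘ spanned) , (λ w i → single-≢𝟎⇒≡ {κ w} {proj₁ (spanned w)}) ,
    λ w graph≢0 → single-self-≢𝟎 {κ w} (graph≢0 ∘ trans (sym (proj₂ (spanned w))))
    where
    c : Coef
    c w = single (κ w) (proj₁ (spanned w))

  relation-through-new-element : ∀ {S v} (τ : Fin n → Fin 3) → (∀ w → w ≢ v → S ∋ w , τ w) →
    ∃ λ x → ∃ λ c → IsRelation c × c v x ≢ 𝟎 × (∀ w i → c w i ≢ 𝟎 → insert S v x ∋ w , i)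
  relation-through-new-element {S} {v} τ hits with admissible-vector τ v
  ... | p , spanned-off-v , graph-v≢0 with spanned-at-v {τ} p spanned-off-v
  ...   | x , spanned-v =
    let (c , rel , c-at-κ , c-κ≢0) = relation-on-lines κ p spanned
    in x , c , rel , subst (λ k → c v k ≢ 𝟎) κ-v (c-κ≢0 v graph-v≢0) , c⊆insert c c-at-κ
    where
    κ : Fin n → Fin 3
    κ = Vector.updateAt τ v (λ _ → x)

    κ-v : κ v ≡ x
    κ-v = updateAt-updates v τ

    κ-w : ∀ {w} → w ≢ v → κ w ≡ τ w
    κ-w {w} w≢v = updateAt-minimal w v τ w≢v

    spanned : ∀ w → SpannedBy (κ w) (graph A p w)
    spanned w with w Fin.≟ v
    ... | yes refl = subst (λ k → SpannedBy k (graph A p w)) (sym κ-v) spanned-v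
    ... | no  w≢v  = subst (λ k → SpannedBy k (graph A p w)) (sym (κ-w w≢v)) (spanned-off-v w w≢v)

    c⊆insert : ∀ c → (∀ w i → c w i ≢ 𝟎 → i ≡ κ w) → ∀ w i → c w i ≢ 𝟎 → insert S v x ∋ w , i
    c⊆insert c c-at-κ w i cwi≢0 with w Fin.≟ v
    ... | yes refl = subst (λ j → insert S v x ∋ v , j) (sym (trans (c-at-κ w i cwi≢0) κ-v)) (∈-insert-self S v x)
    ... | no  w≢v  = ∈-insert⁺ S v x
                       (subst (λ j → S ∋ w , j) (trans (sym (κ-w w≢v)) (sym (c-at-κ w i cwi≢0))) (hits w w≢v))

  Z-isTight : IsTight (Z A)
  Z-isTight S S-st ∣S∣≡ v v∉S =
    let (τ , index) = subtransversal-index S S-st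
        hits : ∀ w → w ≢ v → S ∋ w , τ w
        hits w w≢v = let (j , j∈S) = meets-other-classes {S = S} S-st ∣S∣≡ v∉S w w≢v
                     in subst (λ j → S ∋ w , j) (index w j j∈S) j∈S
        (x , c , rel , cvx≢0 , c⊆S+x) = relation-through-new-element {S} {v} τ hits
        (C , circuit , C⊆c , x∈C) = circuit-through c rel cvx≢0
        (T′ , T′-tr , S+x⊆T′) = insert-subtransversal {S = S} S-st v∉S x
        C⊆S+x : C ⊆ insert S v x
        C⊆S+x w j j∈C = c⊆S+x w j (∈-support⁻ c (C⊆c w j j∈C))
    in x , C , inj₁ ((C⊆S+x , (T′ , T′-tr , λ w j → S+x⊆T′ w j ∘ C⊆S+x w j) , circuit) ,
                     λ (C⊆S , _) → v∉S x (C⊆S v x x∈C))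

mainTheorem12 : (n : ℕ) (A : Matrix n) → InvSymmetric A →
    Σ (Family n) λ 𝒞 → Is3Matroid 𝒞 × IsTight 𝒞 × ShelteredBy (MCircuit A) 𝒞
mainTheorem12 n A A-sym = Z A , Z-isMultimatroid , Z-isTight , M-shelters-Z A
  where open InvSymmetricMatrix A-sym
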